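{- Let $x$ be a node of depth $d \geq 5$ in a top tree in which all clusters are valid and the orientation invariant holds. Then $\mathrm{semi\_splay\_step}(x)$ reduces the depth of $x$ by $1$ and returns a node $x'$ with $d-5 \leq \mathrm{depth}(x') \leq d-2$ such that all nodes modified by the operation lie in the subtree rooted at $x'$.
   Context: Let $F$ be a forest (the underlying forest) in which some vertices are marked as exposed. For a set $C$ of edges of $F$, a vertex $w$ is a boundary vertex of $C$ if $w$ is incident to an edge of $C$ and either $w$ is exposed or $w$ is incident to an edge of $F$ not in $C$. A cluster is a nonempty connected set of edges; it is valid if it has at most two boundary vertices; a valid cluster is a path cluster if it has exactly two boundary vertices and a point cluster if it has zero or one. A top tree for a tree $T$ of $F$ (with at least one edge) is a rooted tree in which every internal node has exactly two children and whose leaves are in bijection with the edges of $T$; each node is identified with the cluster of edges at the leaves of its subtree, every such cluster being connected and valid. The two children of an internal node share exactly one vertex, its central vertex. The depth of a node is its distance to the root (the root has depth $0$). Orientation: each internal node has ordered children (left, right), each leaf has ordered endpoints (left, right). For a leaf, a boundary vertex is its left/right boundary vertex if it is its left/right endpoint; for an internal node, a boundary vertex is middle if it equals the central vertex, and otherwise left/right according to whether it is a boundary vertex of the left/right child. Leftmost boundary vertex: the left one if it exists, else the middle one if it exists, else none; rightmost symmetric. Orientation invariant: for every internal node, the rightmost boundary vertex of the left child and the leftmost boundary vertex of the right child exist and equal the central vertex. Two nodes hang off to the same side if both are left children or both are right children of their respective parents. Rotation: for a node $u$ with parent $y$ and grandparent $z$, with $a=\mathrm{sibling}(u)$, $b=\mathrm{sibling}(y)$,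 $\mathrm{rotate\_up}(u)$ is allowed iff $a\cup b$ is a valid cluster; it makes $a,b$ the children of $y$ and $u,y$ the children of $z$ (other parent–child relations unchanged), then adjusts child orders and orientations (possibly reversing orientations of whole subtrees) so that the orientation invariant holds. Semi-splay step: $\mathrm{semi\_splay\_step}(x)$ does the following. Let $p$ be the parent and $g$ the grandparent of $x$; if either does not exist, return null without changes. If $x$ and $g$ are both point clusters, perform $\mathrm{rotate\_up}(x)$ and return $g$. Otherwise let $gg$ be the parent of $g$; if it does not exist, return null. If $p$ is a path cluster and ($g$ is a path cluster or $gg$ is a point cluster), then: if $x$ and $p$ hang off to the same side, perform $\mathrm{rotate\_up}(x)$ and return $g$; else if $p$ and $g$ hang off to the same side, perform $\mathrm{rotate\_up}(p)$ and return $gg$; else (then $x$ and $g$ hang off to the same side) perform $\mathrm{rotate\_up}(\mathrm{sibling}(x))$ followed by $\mathrm{rotate\_up}(p)$ and return $gg$. In all remaining cases, return $\mathrm{semi\_splay\_step}(p)$. -}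

module Defs where

open import Data.Bool using (Bool; true; false; _∧_; _∨_; not; if_then_else_; T)
open import Data.Nat using (ℕ; zero; suc; _≤_; _≡ᵇ_; _<ᵇ_; _≤ᵇ_)
open import Data.Bool.ListAction using (any)
open import Data.List using (List; []; _∷_; length; filterᵇ; deduplicateᵇ; findᵇ; head; reverse; concatMap)
import Data.List as List
open import Data.Maybe using (Maybe; just; nothing; _<∣>_; maybe′; _>>=_)
import Data.Maybe as Maybe
open import Data.Product using (_×_; _,_; Σ)
open import Data.Unit using (⊤)
open import Relation.Binary.PropositionalEquality using (_≡_; _≢_)
open import Data.List.Relation.Unary.Unique.Propositional using (Unique)

Vertex : Set
Vertex = ℕ

Label : Set
Label = ℕ

Exposure : Set
Exposure = Vertex → Bool

-- A leaf is an edge of the underlying tree T with ordered endpoints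
-- (left , right); an internal node has ordered children (left , right).
-- The cluster of a node is the set of edges at the leaves below it.
data TopTree : Set where
  leaf : (i : Label) (l r : Vertex) → TopTree
  node : (i : Label) (L R : TopTree) → TopTree

label : TopTree → Label
label (leaf i _ _) = i
label (node i _ _) = i

labels : TopTree → List Label
labels (leaf i _ _) = i ∷ []
labels (node i L R) = i ∷ (labels L List.++ labels R)

verts : TopTree → List Vertex
verts (leaf _ l r) = l ∷ r ∷ []
verts (node _ L R) = verts L List.++ verts R

memV : Vertex → List Vertex → Bool
memV v = any (v ≡ᵇ_)

deg : TopTree → Vertex → ℕ
deg (leaf _ l r) w = if (l ≡ᵇ w) ∨ (r ≡ᵇ w) then 1 else 0
deg (node _ L R) w = deg L w Data.Nat.+ deg R w

-- Boundary vertices.  `rt` is the whole top tree (its edges are exactly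
-- the edges of T; edges of F incident to a vertex of T all lie in T).
-- w is a boundary vertex of cluster c iff w is incident to an edge of c
-- and (w is exposed or w is incident to an edge of T not in c).

isBoundary : Exposure → TopTree → TopTree → Vertex → Bool
isBoundary ex rt c w = (0 <ᵇ deg c w) ∧ (ex w ∨ (deg c w <ᵇ deg rt w))

boundary : Exposure → TopTree → TopTree → List Vertex
boundary ex rt c = deduplicateᵇ _≡ᵇ_ (filterᵇ (isBoundary ex rt c) (verts c))

nBoundary : Exposure → TopTree → TopTree → ℕ
nBoundary ex rt c = length (boundary ex rt c)

isValid isPoint isPath : Exposure → TopTree → TopTree → Bool
isValid ex rt c = nBoundary ex rt c ≤ᵇ 2
isPoint ex rt c = nBoundary ex rt c ≤ᵇ 1
isPath  ex rt c = nBoundary ex rt c ≡ᵇ 2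

sharedVerts : TopTree → TopTree → List Vertex
sharedVerts A B = deduplicateᵇ _≡ᵇ_ (filterᵇ (λ v → memV v (verts B)) (verts A))

central : TopTree → Maybe Vertex
central (leaf _ _ _) = nothing
central (node _ L R) = head (sharedVerts L R)

eqMV : Maybe Vertex → Maybe Vertex → Bool
eqMV (just a) (just b) = a ≡ᵇ b
eqMV nothing nothing = true
eqMV _ _ = false

isCentral : TopTree → Vertex → Bool
isCentral c w = maybe′ (w ≡ᵇ_) false (central c)

leftBV rightBV middleBV : Exposure → TopTree → TopTree → Maybe Vertex
leftBV ex rt c@(leaf _ l r) = if isBoundary ex rt c l then just l else nothing
leftBV ex rt c@(node _ L R) =
  findᵇ (λ w → not (isCentral c w) ∧ isBoundary ex rt L w) (boundary ex rt c)
rightBV ex rt c@(leaf _ l r) = if isBoundary ex rt c r then just r else nothing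
rightBV ex rt c@(node _ L R) =
  findᵇ (λ w → not (isCentral c w) ∧ isBoundary ex rt R w) (boundary ex rt c)
middleBV ex rt c@(leaf _ _ _) = nothing
middleBV ex rt c@(node _ _ _) =
  findᵇ (λ w → isCentral c w) (boundary ex rt c)

leftmostBV rightmostBV : Exposure → TopTree → TopTree → Maybe Vertex
leftmostBV ex rt c = leftBV ex rt c <∣> middleBV ex rt c
rightmostBV ex rt c = rightBV ex rt c <∣> middleBV ex rt c

OrientedAt : Exposure → TopTree → TopTree → Set
OrientedAt ex rt (leaf _ _ _) = ⊤
OrientedAt ex rt c@(node _ L R) =
  Σ Vertex λ v → central c ≡ just v
    × rightmostBV ex rt L ≡ just v × leftmostBV ex rt R ≡ just v

orientedAtᵇ : Exposure → TopTree → TopTree → Bool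
orientedAtᵇ ex rt (leaf _ _ _) = true
orientedAtᵇ ex rt c@(node _ L R) with central c
... | nothing = false
... | just v = eqMV (rightmostBV ex rt L) (just v) ∧ eqMV (leftmostBV ex rt R) (just v)

orientedAllᵇ : Exposure → TopTree → TopTree → Bool
orientedAllᵇ ex rt c@(leaf _ _ _) = orientedAtᵇ ex rt c
orientedAllᵇ ex rt c@(node _ L R) =
  orientedAtᵇ ex rt c ∧ orientedAllᵇ ex rt L ∧ orientedAllᵇ ex rt R

AllNodes : (TopTree → Set) → TopTree → Set
AllNodes P c@(leaf _ _ _) = P c
AllNodes P c@(node _ L R) = P c × AllNodes P L × AllNodes P R

ProperLeaf : TopTree → Set
ProperLeaf (leaf _ l r) = l ≢ r
ProperLeaf (node _ _ _) = ⊤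

-- the two children of an internal node share exactly one vertex
-- (together with ProperLeaf this makes every cluster connected and the
-- whole edge set a tree)
ShareOne : TopTree → Set
ShareOne (leaf _ _ _) = ⊤
ShareOne (node _ L R) = length (sharedVerts L R) ≡ 1

ValidCluster : Exposure → TopTree → TopTree → Set
ValidCluster ex rt c = nBoundary ex rt c ≤ 2

record IsOrientedTopTree (ex : Exposure) (t : TopTree) : Set where
  field
    uniqueLabels : Unique (labels t)
    properLeaves : AllNodes ProperLeaf t
    shareOne     : AllNodes ShareOne t
    allValid     : AllNodes (ValidCluster ex t) t
    oriented     : AllNodes (OrientedAt ex t) t

data Side : Set where
  left right : Side

flipSide : Side → Side
flipSide left = right
flipSide right = left

sameSide : Side → Side → Bool
sameSide left left = true
sameSide right right = true
sameSide _ _ = false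

-- top-down paths
get : List Side → TopTree → Maybe TopTree
get [] t = just t
get (_ ∷ _) (leaf _ _ _) = nothing
get (left ∷ p) (node _ L R) = get p L
get (right ∷ p) (node _ L R) = get p R

replace : List Side → TopTree → TopTree → TopTree
replace [] s t = s
replace (_ ∷ _) s t@(leaf _ _ _) = t
replace (left ∷ p) s (node i L R) = node i (replace p s L) R
replace (right ∷ p) s (node i L R) = node i L (replace p s R)

findPath : Label → TopTree → Maybe (List Side)
findPath n (leaf i _ _) = if i ≡ᵇ n then just [] else nothing
findPath n (node i L R) =
  if i ≡ᵇ n then just []
  else (Maybe.map (left ∷_) (findPath n L) <∣> Maybe.map (right ∷_) (findPath n R))

depth : Label → TopTree → Maybe ℕ
depth n t = Maybe.map length (findPath n t)

subtreeLabels : Label → TopTree → List Label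
subtreeLabels n t = maybe′ labels [] (findPath n t >>= λ p → get p t)

rev : TopTree → TopTree
rev (leaf i l r) = leaf i r l
rev (node i L R) = node i (rev R) (rev L)

revIf : Bool → TopTree → TopTree
revIf b t = if b then rev t else t

ordered : Label → Bool → TopTree → TopTree → TopTree
ordered i false A B = node i A B
ordered i true A B = node i B A

bools : List Bool
bools = false ∷ true ∷ []

-- all re-orientations of the restructured subtree: z with children u, y
-- and y with children a, b, with any child orders at z and y, and any
-- of u, a, b reversed.
candidates : Label → Label → TopTree → TopTree → TopTree → List TopTree
candidates iz iy u a b =
  concatMap (λ oz → concatMap (λ oy → concatMap (λ fu → concatMap (λ fa → List.map (λ fb →
    ordered iz oz (revIf fu u) (ordered iy oy (revIf fa a) (revIf fb b)))
    bools) bools) bools) bools) bools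

chooseFirst : (TopTree → Bool) → List TopTree → TopTree → TopTree
chooseFirst p [] d = d
chooseFirst p (c ∷ cs) d = if p c then c else chooseFirst p cs d

child : Side → TopTree → TopTree → TopTree
child left A B = A
child right A B = B

-- a ∪ b is a valid cluster (connected, at most two boundary vertices);
-- the label 0 of the auxiliary node is irrelevant
allowed : Exposure → TopTree → TopTree → TopTree → Bool
allowed ex rt a b = (0 <ᵇ length (sharedVerts a b)) ∧ isValid ex rt (node 0 a b)

-- the restructured and re-oriented tree, given z's top-down path pz,
-- the side sy of y below z and the side su of u below y
rotateCore : Exposure → TopTree → List Side → Side → Side → TopTree → Maybe TopTree
rotateCore ex t pz sy su (node iz Z1 Z2) with child sy Z1 Z2
... | leaf _ _ _ = nothing
... | node iy Y1 Y2 =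
  let b = child (flipSide sy) Z1 Z2
      u = child su Y1 Y2
      a = child (flipSide su) Y1 Y2
      cs = List.map (λ c → replace pz c t) (candidates iz iy u a b)
  in if allowed ex t a b
     then just (chooseFirst (orientedAllᵇ ex t) cs (replace pz (node iz u (node iy a b)) t))
     else nothing
rotateCore ex t pz sy su (leaf _ _ _) = nothing

-- rotate_up at a node given by its bottom-up path
rotateUpAt : Exposure → TopTree → List Side → Maybe TopTree
rotateUpAt ex t (su ∷ sy ∷ rz) =
  get (reverse rz) t >>= rotateCore ex t (reverse rz) sy su
rotateUpAt ex t _ = nothing

-- rotate_up(n); nothing if n has no grandparent or the rotation is not allowed
rotateUp : Exposure → TopTree → Label → Maybe TopTree
rotateUp ex t n = findPath n t >>= λ p → rotateUpAt ex t (reverse p)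

data Result : Set where
  null : Result
  fail : Result                       -- a prescribed rotation was not allowed
  ret  : TopTree → Label → Result

-- bottom-up paths
getR : List Side → TopTree → Maybe TopTree
getR rp t = get (reverse rp) t

labelAtR : List Side → TopTree → Maybe Label
labelAtR rp t = Maybe.map label (getR rp t)

pointAt pathAt : Exposure → TopTree → List Side → Bool
pointAt ex t rp = maybe′ (isPoint ex t) false (getR rp t)
pathAt ex t rp = maybe′ (isPath ex t) false (getR rp t)

rotL : Exposure → Maybe TopTree → Maybe Label → Maybe TopTree
rotL ex (just t) (just n) = rotateUp ex t n
rotL ex _ _ = nothing

finish : Maybe TopTree → Maybe Label → Result
finish (just t') (just n) = ret t' n
finish _ _ = fail

step : Exposure → TopTree → List Side → Result
step ex t [] = null
step ex t (_ ∷ []) = null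
step ex t (sx ∷ sp ∷ []) =
  if pointAt ex t (sx ∷ sp ∷ []) ∧ pointAt ex t []
  then finish (rotL ex (just t) (labelAtR (sx ∷ sp ∷ []) t)) (labelAtR [] t)
  else null
step ex t (sx ∷ sp ∷ sg ∷ rgg) =
  let rx = sx ∷ sp ∷ sg ∷ rgg
      rp = sp ∷ sg ∷ rgg
      rg = sg ∷ rgg
  in if pointAt ex t rx ∧ pointAt ex t rg
     then finish (rotL ex (just t) (labelAtR rx t)) (labelAtR rg t)
     else if pathAt ex t rp ∧ (pathAt ex t rg ∨ pointAt ex t rgg)
     then (if sameSide sx sp
           then finish (rotL ex (just t) (labelAtR rx t)) (labelAtR rg t)
           else if sameSide sp sg
           then finish (rotL ex (just t) (labelAtR rp t)) (labelAtR rgg t)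
           else finish (rotL ex (rotL ex (just t) (labelAtR (flipSide sx ∷ rp) t))
                                (labelAtR rp t))
                       (labelAtR rgg t))
     else step ex t (sp ∷ sg ∷ rgg)

semiSplayStep : Exposure → TopTree → Label → Result
semiSplayStep ex t x = maybe′ (λ p → step ex t (reverse p)) null (findPath x t)

-- Modified nodes: a node is modified if its parent, or its ordered
-- children (resp. ordered endpoints, for a leaf), changed.

data LocalKids : Set where
  ends : Vertex → Vertex → LocalKids
  kids : Label → Label → LocalKids

localInfo : Maybe Label → Label → TopTree → Maybe (Maybe Label × LocalKids)
localInfo par n (leaf i l r) = if i ≡ᵇ n then just (par , ends l r) else nothing
localInfo par n (node i L R) =
  if i ≡ᵇ n then just (par , kids (label L) (label R))
  else (localInfo (just i) n L <∣> localInfo (just i) n R)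

Modified : TopTree → TopTree → Label → Set
Modified t t' n = localInfo nothing n t ≢ localInfo nothing n t'

-- Every outcome of semi_splay_step is a single rotation, or a zig-zag pair of rotations,
-- around an ancestor of x at most three levels up, or a fall-through to the parent; with
-- isPath = not isPoint on valid clusters, the conditions of the step at x, its parent and
-- its grandparent cannot all fail, so there are at most two fall-throughs.  Every rotation
-- performed is allowed: the boundary vertices of the new cluster a ∪ b are boundary vertices
-- of the grandparent z or the joint of u and a, and the point/path conditions of the step,
-- together with the orientation invariant (which puts the joint of z's children into a
-- when u and y hang to the same side), leave room for at most two of them.  A rotation
-- replaces the subtree of the returned node by a rearrangement of its own nodes, which
-- yields the depths and confines all modified nodes to that subtree.

module Submission where

open import Defs
open import Data.Bool using (Bool; true; false; _∧_; _∨_; not; T; T?)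
open import Data.Bool.Properties using (T-∧; T-∨; T-≡)
open import Data.Empty using (⊥; ⊥-elim)
open import Data.List using (List; []; _∷_; length; filterᵇ; deduplicateᵇ; findᵇ; _++_; map; reverse; concatMap)
import Data.List as List
open import Data.List.Properties
  using (++-assoc; ++-identityʳ; length-++; length-map; length-reverse; reverse-involutive; unfold-reverse)
open import Data.List.Membership.Propositional using (_∈_; _∉_)
open import Data.List.Membership.Propositional.Properties
  using (∈-filter⁻; ∈-filter⁺; ∈-deduplicate⁻; ∈-++⁺ˡ; ∈-++⁺ʳ; ∈-++⁻)
import Data.List.Membership.Setoid.Properties as SetoidMembership
open import Data.List.Relation.Unary.Any using (here; there)
import Data.List.Relation.Unary.Any as Any
open import Data.List.Relation.Unary.Any.Properties using (any⁺; any⁻)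
open import Data.List.Relation.Unary.All using (All; []; _∷_; lookup)
import Data.List.Relation.Unary.All as All
open import Data.List.Relation.Unary.All.Properties using (all-filter; map⁺; concat⁺)
open import Data.List.Relation.Unary.AllPairs using ([]; _∷_)
open import Data.List.Relation.Unary.Unique.Propositional using (Unique)
import Data.List.Relation.Unary.Unique.Propositional.Properties as Unique
open import Data.List.Relation.Binary.Disjoint.Propositional using (Disjoint)
open import Data.List.Relation.Binary.Permutation.Propositional
  using (_↭_; ↭-refl; ↭-prep; ↭-trans; ↭-sym; ↭-reflexive; ↭⇒↭ₛ)
open import Data.List.Relation.Binary.Permutation.Propositional.Properties using (++⁺; ++-comm; shift; ∈-resp-↭)
import Data.List.Relation.Binary.Permutation.Setoid.Properties as ↭ₛ
open import Data.Maybe using (Maybe; just; nothing; _<∣>_)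
import Data.Maybe as Maybe
open import Data.Nat using (ℕ; zero; suc; _+_; _∸_; _≤_; _<_; _≡ᵇ_; _<ᵇ_; _≤ᵇ_; z≤n; s≤s)
open import Data.Nat.Properties
  using (≡ᵇ⇒≡; ≡⇒≡ᵇ; <ᵇ⇒<; <⇒<ᵇ; ≤ᵇ⇒≤; ≤⇒≤ᵇ; _≟_; _<?_; ≤-refl; ≤-trans; ≤-<-trans; <-≤-trans;
         m≤m+n; m≤n+m; m<m+n; n≤1+n; +-assoc; +-comm; +-identityʳ; +-suc; ∸-monoˡ-≤; +-monoˡ-≤)
open import Data.Nat.Solver using (module +-*-Solver)
open import Data.List.Membership.DecPropositional _≟_ using (_∈?_)
open import Data.Product using (Σ; _×_; _,_; proj₁; proj₂; map₁)
open import Data.Sum using (_⊎_; inj₁; inj₂; [_,_]′)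
import Data.Sum as Sum
open import Function using (_∘_; _∘₂_)
open import Function.Bundles using (Equivalence)
open import Relation.Nullary using (¬_; ¬?; Dec; yes; no)
open import Relation.Nullary.Decidable using (_×-dec_; _⊎-dec_)
open import Relation.Binary.PropositionalEquality
  using (_≡_; _≢_; refl; sym; trans; cong; cong₂; subst; subst₂; setoid)

open +-*-Solver using (solve; _:+_; _:=_)

≡ᵇ-refl : ∀ n → (n ≡ᵇ n) ≡ true
≡ᵇ-refl n = Equivalence.to T-≡ (≡⇒≡ᵇ n n refl)

≢⇒≡ᵇ≡false : ∀ {m n} → m ≢ n → (m ≡ᵇ n) ≡ false
≢⇒≡ᵇ≡false {m} {n} m≢n with m ≡ᵇ n in eq
... | true  = ⊥-elim (m≢n (≡ᵇ⇒≡ m n (subst T (sym eq) _)))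
... | false = refl

∧-true : ∀ {a b} → (a ∧ b) ≡ true → T a × T b
∧-true {true} {true} _ = _ , _

∨-true : ∀ {a b} → (a ∨ b) ≡ true → T a ⊎ T b
∨-true {true}         _ = inj₁ _
∨-true {false} {true} _ = inj₂ _

findᵇ-just : ∀ (p : Vertex → Bool) xs {w} → findᵇ p xs ≡ just w → w ∈ xs × T (p w)
findᵇ-just p (x ∷ xs) found with p x in px
findᵇ-just p (x ∷ xs) refl | true = here refl , subst T (sym px) _
... | false = map₁ there (findᵇ-just p xs found)

findᵇ-nothing : ∀ (p : Vertex → Bool) xs → findᵇ p xs ≡ nothing → ∀ {w} → w ∈ xs → ¬ T (p w)
findᵇ-nothing p (x ∷ xs) none m with p x in px
findᵇ-nothing p (x ∷ xs) () m | true
findᵇ-nothing p (x ∷ xs) none (here refl) | false = subst T px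
findᵇ-nothing p (x ∷ xs) none (there m)   | false = findᵇ-nothing p xs none m

deduplicateᵇ-unique : ∀ xs → Unique (deduplicateᵇ _≡ᵇ_ xs)
deduplicateᵇ-unique [] = []
deduplicateᵇ-unique (x ∷ xs) =
  All.map (λ x≢ᵇy x≡y → x≢ᵇy (≡⇒≡ᵇ x _ x≡y)) (all-filter x≢ᵇ? (deduplicateᵇ _≡ᵇ_ xs))
    ∷ Unique.filter⁺ x≢ᵇ? (deduplicateᵇ-unique xs)
  where
  x≢ᵇ? : ∀ y → Dec (¬ T (x ≡ᵇ y))
  x≢ᵇ? y = ¬? (T? (x ≡ᵇ y))

∈-deduplicateᵇ⁺ : ∀ {xs w} → w ∈ xs → w ∈ deduplicateᵇ _≡ᵇ_ xs
∈-deduplicateᵇ⁺ = SetoidMembership.∈-deduplicate⁺ (setoid ℕ) _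
  (λ {_} {y} {z} z≡ᵇy x≡y → trans x≡y (sym (≡ᵇ⇒≡ z y z≡ᵇy)))

Unique-resp-↭ : ∀ {xs ys : List Label} → xs ↭ ys → Unique xs → Unique ys
Unique-resp-↭ p = ↭ₛ.Unique-resp-↭ (setoid ℕ) (↭⇒↭ₛ p)

Unique-++⁻ : ∀ (xs : List Label) {ys} → Unique (xs ++ ys) → Unique xs × Unique ys × Disjoint xs ys
Unique-++⁻ []       u       = [] , u , λ ()
Unique-++⁻ (x ∷ xs) (x∉ ∷ u) with uxs , uys , disj ← Unique-++⁻ xs u =
  prefix x∉ ∷ uxs , uys , λ { (here refl , y) → lookup x∉ (∈-++⁺ʳ xs y) refl ; (there m , y) → disj (m , y) }
  where
  prefix : ∀ {zs} → All (x ≢_) (zs ++ _) → All (x ≢_) zs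
  prefix {[]}     _        = []
  prefix {_ ∷ zs} (p ∷ ps) = p ∷ prefix ps

AtMost₁ AtMost₂ TwoDistinct : (Vertex → Set) → Set
AtMost₁ P = Σ Vertex λ v → ∀ w → P w → w ≡ v
AtMost₂ P = Σ Vertex λ v₁ → Σ Vertex λ v₂ → ∀ w → P w → w ≡ v₁ ⊎ w ≡ v₂
TwoDistinct P = Σ Vertex λ v₁ → Σ Vertex λ v₂ → v₁ ≢ v₂ × P v₁ × P v₂

length≤1⇒AtMost₁ : ∀ xs → length xs ≤ 1 → AtMost₁ (_∈ xs)
length≤1⇒AtMost₁ []          _ = 0 , λ _ ()
length≤1⇒AtMost₁ (a ∷ [])    _ = a , λ { _ (here e) → e }
length≤1⇒AtMost₁ (_ ∷ _ ∷ _) (s≤s ())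

length≤2⇒AtMost₂ : ∀ xs → length xs ≤ 2 → AtMost₂ (_∈ xs)
length≤2⇒AtMost₂ []              _ = 0 , 0 , λ _ ()
length≤2⇒AtMost₂ (a ∷ [])        _ = a , a , λ { _ (here e) → inj₁ e }
length≤2⇒AtMost₂ (a ∷ b ∷ [])    _ = a , b , λ { _ (here e) → inj₁ e ; _ (there (here e)) → inj₂ e }
length≤2⇒AtMost₂ (_ ∷ _ ∷ _ ∷ _) (s≤s (s≤s ()))

length≡2⇒TwoDistinct : ∀ xs → Unique xs → length xs ≡ 2 → TwoDistinct (_∈ xs)
length≡2⇒TwoDistinct (a ∷ b ∷ []) ((a≢b ∷ []) ∷ _) refl = a , b , a≢b , here refl , there (here refl)

AtMost₂-¬three : ∀ {P} → AtMost₂ P → ∀ {a b c} → P a → P b → P c → a ≢ b → a ≢ c → b ≢ c → ⊥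
AtMost₂-¬three (v₁ , v₂ , f) {a} {b} {c} pa pb pc a≢b a≢c b≢c with f a pa | f b pb | f c pc
... | inj₁ refl | inj₁ refl | _         = a≢b refl
... | inj₂ refl | inj₂ refl | _         = a≢b refl
... | inj₁ refl | _         | inj₁ refl = a≢c refl
... | inj₂ refl | _         | inj₂ refl = a≢c refl
... | _         | inj₁ refl | inj₁ refl = b≢c refl
... | _         | inj₂ refl | inj₂ refl = b≢c refl

AtMost₂⇒length≤2 : ∀ xs → Unique xs → AtMost₂ (_∈ xs) → length xs ≤ 2
AtMost₂⇒length≤2 []           _ _ = z≤n
AtMost₂⇒length≤2 (_ ∷ [])     _ _ = s≤s z≤n
AtMost₂⇒length≤2 (_ ∷ _ ∷ []) _ _ = s≤s (s≤s z≤n)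
AtMost₂⇒length≤2 (a ∷ b ∷ c ∷ _) ((a≢b ∷ a≢c ∷ _) ∷ (b≢c ∷ _) ∷ _) am =
  ⊥-elim (AtMost₂-¬three am (here refl) (there (here refl)) (there (there (here refl))) a≢b a≢c b≢c)

AtMost₁-¬two : ∀ {P} → AtMost₁ P → ∀ {a b} → P a → P b → a ≢ b → ⊥
AtMost₁-¬two (v , f) {a} {b} pa pb a≢b with f a pa | f b pb
... | refl | refl = a≢b refl

AtMost₂-other : ∀ {P} → AtMost₂ P → ∀ {w₁ w₂ q} → P w₁ → P w₂ → w₁ ≢ w₂ → P q → q ≡ w₁ ⊎ q ≡ w₂
AtMost₂-other am {w₁} {w₂} {q} p₁ p₂ w₁≢w₂ pq with q ≟ w₁ | q ≟ w₂
... | yes q≡w₁ | _        = inj₁ q≡w₁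
... | no _     | yes q≡w₂ = inj₂ q≡w₂
... | no q≢w₁  | no q≢w₂  = ⊥-elim (AtMost₂-¬three am p₁ p₂ pq w₁≢w₂ (q≢w₁ ∘ sym) (q≢w₂ ∘ sym))

AtMost₂-of-three : ∀ {P} → (∀ w → Dec (P w)) → ∀ c₁ c₂ c₃ → (∀ w → P w → w ≡ c₁ ⊎ w ≡ c₂ ⊎ w ≡ c₃) →
  (P c₁ → P c₂ → P c₃ → c₁ ≢ c₂ → c₁ ≢ c₃ → c₂ ≢ c₃ → ⊥) → AtMost₂ P
AtMost₂-of-three P? c₁ c₂ c₃ cover ¬three with P? c₁ | P? c₂ | P? c₃
... | _ | _ | no ¬p₃ =
  c₁ , c₂ , λ w pw → [ inj₁ , [ inj₂ , (λ { refl → ⊥-elim (¬p₃ pw) }) ]′ ]′ (cover w pw)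
... | no ¬p₁ | _ | yes _ =
  c₂ , c₃ , λ w pw → [ (λ { refl → ⊥-elim (¬p₁ pw) }) , (λ c → c) ]′ (cover w pw)
... | yes _ | no ¬p₂ | yes _ =
  c₁ , c₃ , λ w pw → [ inj₁ , [ (λ { refl → ⊥-elim (¬p₂ pw) }) , inj₂ ]′ ]′ (cover w pw)
... | yes p₁ | yes p₂ | yes p₃ with c₁ ≟ c₂ | c₁ ≟ c₃ | c₂ ≟ c₃
...   | yes refl | _ | _ = c₁ , c₃ , λ w pw → [ inj₁ , [ inj₁ , inj₂ ]′ ]′ (cover w pw)
...   | no _ | yes refl | _ = c₁ , c₂ , λ w pw → [ inj₁ , [ inj₂ , inj₁ ]′ ]′ (cover w pw)
...   | no _ | no _ | yes refl = c₁ , c₂ , λ w pw → [ inj₁ , [ inj₂ , inj₂ ]′ ]′ (cover w pw)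
...   | no c₁≢c₂ | no c₁≢c₃ | no c₂≢c₃ = ⊥-elim (¬three p₁ p₂ p₃ c₁≢c₂ c₁≢c₃ c₂≢c₃)

TwoDistinct-avoid : ∀ {P} → TwoDistinct P → ∀ c → Σ Vertex λ q → P q × q ≢ c
TwoDistinct-avoid (v₁ , v₂ , v₁≢v₂ , p₁ , p₂) c with v₁ ≟ c
... | yes refl = v₂ , p₂ , v₁≢v₂ ∘ sym
... | no v₁≢c  = v₁ , p₁ , v₁≢c

-- Clusters through degrees

Incident : (Vertex → ℕ) → Vertex → Set
Incident C w = 0 < C w

-- For C = deg c and R = deg rt this is isBoundary: w lies on an edge outside c iff C w < R w.
BoundaryOf : Exposure → (Vertex → ℕ) → (Vertex → ℕ) → Vertex → Set
BoundaryOf ex R C w = Incident C w × (T (ex w) ⊎ C w < R w)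

isBoundary⇒BoundaryOf : ∀ ex rt c w → T (isBoundary ex rt c w) → BoundaryOf ex (deg rt) (deg c) w
isBoundary⇒BoundaryOf ex rt c w h with Equivalence.to (T-∧ {0 <ᵇ deg c w}) h
... | inc , out = <ᵇ⇒< 0 (deg c w) inc , Sum.map₂ (<ᵇ⇒< (deg c w) (deg rt w)) (Equivalence.to (T-∨ {ex w}) out)

BoundaryOf⇒isBoundary : ∀ ex rt c w → BoundaryOf ex (deg rt) (deg c) w → T (isBoundary ex rt c w)
BoundaryOf⇒isBoundary ex rt c w (inc , out) =
  Equivalence.from (T-∧ {0 <ᵇ deg c w}) (<⇒<ᵇ inc , Equivalence.from (T-∨ {ex w}) (Sum.map₂ <⇒<ᵇ out))

incident⇒∈verts : ∀ c w → Incident (deg c) w → w ∈ verts c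
incident⇒∈verts (leaf i l r) w p with l ≡ᵇ w in l≡w | r ≡ᵇ w in r≡w
... | true  | _    = here (sym (≡ᵇ⇒≡ l w (subst T (sym l≡w) _)))
... | false | true = there (here (sym (≡ᵇ⇒≡ r w (subst T (sym r≡w) _))))
incident⇒∈verts (node i L R) w p with deg L w in degL
... | suc _ = ∈-++⁺ˡ (incident⇒∈verts L w (subst (0 <_) (sym degL) (s≤s z≤n)))
... | zero  = ∈-++⁺ʳ (verts L) (incident⇒∈verts R w p)

∈verts⇒incident : ∀ c w → w ∈ verts c → Incident (deg c) w
∈verts⇒incident (leaf i l r) w (here refl) rewrite ≡ᵇ-refl l = s≤s z≤n
∈verts⇒incident (leaf i l r) w (there (here refl)) rewrite ≡ᵇ-refl r with l ≡ᵇ r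
... | true  = s≤s z≤n
... | false = s≤s z≤n
∈verts⇒incident (node i L R) w m with ∈-++⁻ (verts L) m
... | inj₁ inL = <-≤-trans (∈verts⇒incident L w inL) (m≤m+n (deg L w) (deg R w))
... | inj₂ inR = <-≤-trans (∈verts⇒incident R w inR) (m≤n+m (deg R w) (deg L w))

module _ (ex : Exposure) (rt c : TopTree) where

  private
    Bd : Vertex → Set
    Bd = BoundaryOf ex (deg rt) (deg c)

  ∈-boundary⁻ : ∀ {w} → w ∈ boundary ex rt c → Bd w
  ∈-boundary⁻ {w} m = isBoundary⇒BoundaryOf ex rt c w (proj₂ (∈-filter⁻ (T? ∘ isBoundary ex rt c) {xs = verts c}
    (∈-deduplicate⁻ (T? ∘₂ _≡ᵇ_) (filterᵇ (isBoundary ex rt c) (verts c)) m)))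

  ∈-boundary⁺ : ∀ {w} → Bd w → w ∈ boundary ex rt c
  ∈-boundary⁺ {w} b = ∈-deduplicateᵇ⁺
    (∈-filter⁺ (T? ∘ isBoundary ex rt c) (incident⇒∈verts c w (proj₁ b)) (BoundaryOf⇒isBoundary ex rt c w b))

  boundary-unique : Unique (boundary ex rt c)
  boundary-unique = deduplicateᵇ-unique _

  valid⇒AtMost₂ : nBoundary ex rt c ≤ 2 → AtMost₂ Bd
  valid⇒AtMost₂ valid with length≤2⇒AtMost₂ (boundary ex rt c) valid
  ... | v₁ , v₂ , f = v₁ , v₂ , λ w b → f w (∈-boundary⁺ b)

  AtMost₂⇒valid : AtMost₂ Bd → nBoundary ex rt c ≤ 2
  AtMost₂⇒valid (v₁ , v₂ , f) = AtMost₂⇒length≤2 _ boundary-unique (v₁ , v₂ , λ w m → f w (∈-boundary⁻ m))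

  point⇒AtMost₁ : T (isPoint ex rt c) → AtMost₁ Bd
  point⇒AtMost₁ point with length≤1⇒AtMost₁ (boundary ex rt c) (≤ᵇ⇒≤ _ 1 point)
  ... | v , f = v , λ w b → f w (∈-boundary⁺ b)

  path⇒TwoDistinct : T (isPath ex rt c) → TwoDistinct Bd
  path⇒TwoDistinct path with length≡2⇒TwoDistinct (boundary ex rt c) boundary-unique (≡ᵇ⇒≡ _ 2 path)
  ... | v₁ , v₂ , v₁≢v₂ , m₁ , m₂ = v₁ , v₂ , v₁≢v₂ , ∈-boundary⁻ m₁ , ∈-boundary⁻ m₂

  isPath≡not-isPoint : nBoundary ex rt c ≤ 2 → isPath ex rt c ≡ not (isPoint ex rt c)
  isPath≡not-isPoint valid with nBoundary ex rt c
  ... | 0 = refl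
  ... | 1 = refl
  ... | 2 = refl
  isPath≡not-isPoint (s≤s (s≤s ())) | suc (suc (suc _))

_⊕_ : (Vertex → ℕ) → (Vertex → ℕ) → Vertex → ℕ
(A ⊕ B) w = A w + B w

Adjacent : (Vertex → ℕ) → (Vertex → ℕ) → Set
Adjacent A B = Σ Vertex λ w → Incident A w × Incident B w

JoinedAt : (Vertex → ℕ) → (Vertex → ℕ) → Vertex → Set
JoinedAt A B v = Incident A v × Incident B v × (∀ w → Incident A w → Incident B w → w ≡ v)

JoinedAt-sym : ∀ {A B v} → JoinedAt A B v → JoinedAt B A v
JoinedAt-sym (inA , inB , unique) = inB , inA , λ w b a → unique w a b

JoinedAt-children : ∀ s A B {c} → JoinedAt (deg A) (deg B) c →
  JoinedAt (deg (child s A B)) (deg (child (flipSide s) A B)) c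
JoinedAt-children left  A B joined = joined
JoinedAt-children right A B joined = JoinedAt-sym joined

∈-sharedVerts⁻ : ∀ A B {w} → w ∈ sharedVerts A B → w ∈ verts A × w ∈ verts B
∈-sharedVerts⁻ A B {w} m with ∈-filter⁻ (T? ∘ λ v → memV v (verts B)) {xs = verts A}
                                (∈-deduplicate⁻ (T? ∘₂ _≡ᵇ_) _ m)
... | inA , memB = inA , Any.map (≡ᵇ⇒≡ w _) (any⁻ (w ≡ᵇ_) (verts B) memB)

∈-sharedVerts⁺ : ∀ A B {w} → w ∈ verts A → w ∈ verts B → w ∈ sharedVerts A B
∈-sharedVerts⁺ A B {w} inA inB = ∈-deduplicateᵇ⁺
  (∈-filter⁺ (T? ∘ λ v → memV v (verts B)) inA (any⁺ (w ≡ᵇ_) (Any.map (≡⇒≡ᵇ w _) inB)))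

shareOne⇒central : ∀ i L R → ShareOne (node i L R) →
  Σ Vertex λ v → central (node i L R) ≡ just v × JoinedAt (deg L) (deg R) v
shareOne⇒central i L R one with sharedVerts L R in shared
... | v ∷ [] = v , refl , ∈verts⇒incident L v (proj₁ inLR) , ∈verts⇒incident R v (proj₂ inLR) , unique
  where
  inLR : v ∈ verts L × v ∈ verts R
  inLR = ∈-sharedVerts⁻ L R (subst (v ∈_) (sym shared) (here refl))
  unique : ∀ w → Incident (deg L) w → Incident (deg R) w → w ≡ v
  unique w a b with subst (w ∈_) shared (∈-sharedVerts⁺ L R (incident⇒∈verts L w a) (incident⇒∈verts R w b))
  ... | here w≡v = w≡v

allowed-intro : ∀ ex rt a b → Adjacent (deg a) (deg b) → AtMost₂ (BoundaryOf ex (deg rt) (deg a ⊕ deg b)) →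
  allowed ex rt a b ≡ true
allowed-intro ex rt a b (w , inA , inB) am with sharedVerts a b in shared
... | [] with subst (w ∈_) shared (∈-sharedVerts⁺ a b (incident⇒∈verts a w inA) (incident⇒∈verts b w inB))
...   | ()
allowed-intro ex rt a b (w , inA , inB) am | _ ∷ _
  with nBoundary ex rt (node 0 a b) ≤ᵇ 2 | ≤⇒≤ᵇ (AtMost₂⇒valid ex rt (node 0 a b) am)
... | true | _ = refl

-- The orientation invariant

-- v is the boundary vertex of C (with central vertex c) lying towards its child K,
-- as leftmostBV and rightmostBV select it.
Outermost : Exposure → (Vertex → ℕ) → (Vertex → ℕ) → (Vertex → ℕ) → Vertex → Vertex → Set
Outermost ex R C K c v =
  BoundaryOf ex R C v × Incident K v × (v ≡ c → ∀ w → BoundaryOf ex R C w → w ≢ c → ¬ BoundaryOf ex R K w)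

sideBV-outermost : ∀ ex rt i C₁ C₂ K c v → let N = node i C₁ C₂ in
  central N ≡ just c → Incident (deg K) c →
  (findᵇ (λ w → not (isCentral N w) ∧ isBoundary ex rt K w) (boundary ex rt N) <∣> middleBV ex rt N) ≡ just v →
  Outermost ex (deg rt) (deg N) (deg K) c v
sideBV-outermost ex rt i C₁ C₂ K c v cen Kc sel
  with findᵇ (λ w → not (isCentral (node i C₁ C₂) w) ∧ isBoundary ex rt K w) (boundary ex rt (node i C₁ C₂))
       in found
... | just v′ with refl ← sel with m , p ← findᵇ-just _ (boundary ex rt (node i C₁ C₂)) found
  with notCentral , bK ← Equivalence.to (T-∧ {not (isCentral (node i C₁ C₂) v)}) p =
  ∈-boundary⁻ ex rt N m , proj₁ (isBoundary⇒BoundaryOf ex rt K v bK) , λ v≡c → ⊥-elim (central-c v≡c notCentral)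
  where
  N : TopTree
  N = node i C₁ C₂
  central-c : v ≡ c → ¬ T (not (isCentral N v))
  central-c refl rewrite cen | ≡ᵇ-refl c = λ ()
... | nothing with m , p ← findᵇ-just (isCentral (node i C₁ C₂)) (boundary ex rt (node i C₁ C₂)) sel =
  ∈-boundary⁻ ex rt N m , subst (Incident (deg K)) (sym v≡c) Kc , onlyCentral
  where
  N : TopTree
  N = node i C₁ C₂
  isCentral≡ : ∀ w → isCentral N w ≡ (w ≡ᵇ c)
  isCentral≡ w rewrite cen = refl
  v≡c : v ≡ c
  v≡c = ≡ᵇ⇒≡ v c (subst T (isCentral≡ v) p)
  onlyCentral : v ≡ c → ∀ w → BoundaryOf ex (deg rt) (deg N) w → w ≢ c → ¬ BoundaryOf ex (deg rt) (deg K) w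
  onlyCentral _ w bN w≢c bK = findᵇ-nothing _ (boundary ex rt N) found (∈-boundary⁺ ex rt N bN)
    (Equivalence.from (T-∧ {not (isCentral N w)}) (notCentral , BoundaryOf⇒isBoundary ex rt K w bK))
    where
    notCentral : T (not (isCentral N w))
    notCentral rewrite isCentral≡ w with w ≡ᵇ c in w≡ᵇc
    ... | true  = w≢c (≡ᵇ⇒≡ w c (subst T (sym w≡ᵇc) _))
    ... | false = _

child-outermost : ∀ ex rt iz Z₁ Z₂ cz sy iy Y₁ Y₂ cy →
  OrientedAt ex rt (node iz Z₁ Z₂) → central (node iz Z₁ Z₂) ≡ just cz →
  child sy Z₁ Z₂ ≡ node iy Y₁ Y₂ → central (node iy Y₁ Y₂) ≡ just cy → JoinedAt (deg Y₁) (deg Y₂) cy →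
  Outermost ex (deg rt) (deg (node iy Y₁ Y₂)) (deg (child (flipSide sy) Y₁ Y₂)) cy cz
child-outermost ex rt iz Z₁ Z₂ cz left iy Y₁ Y₂ cy (v , cenZ , rightmost , _) cenZ′ refl cenY (_ , inY₂ , _)
  with refl ← trans (sym cenZ′) cenZ = sideBV-outermost ex rt iy Y₁ Y₂ Y₂ cy cz cenY inY₂ rightmost
child-outermost ex rt iz Z₁ Z₂ cz right iy Y₁ Y₂ cy (v , cenZ , _ , leftmost) cenZ′ refl cenY (inY₁ , _ , _)
  with refl ← trans (sym cenZ′) cenZ = sideBV-outermost ex rt iy Y₁ Y₂ Y₁ cy cz cenY inY₁ leftmost

-- Validity of the clusters joined by a rotation

module Clusters (ex : Exposure) (R : Vertex → ℕ) where

  Boundary : (Vertex → ℕ) → Vertex → Set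
  Boundary = BoundaryOf ex R

  ValidUnion : (Vertex → ℕ) → (Vertex → ℕ) → Set
  ValidUnion a b = Adjacent a b × AtMost₂ (Boundary (a ⊕ b))

  boundary? : ∀ C w → Dec (Boundary C w)
  boundary? C w = (0 <? C w) ×-dec (T? (ex w) ⊎-dec (C w <? R w))

  incident? : ∀ C w → Dec (Incident C w)
  incident? C w = 0 <? C w

  ¬incident⇒≡0 : ∀ C w → ¬ Incident C w → C w ≡ 0
  ¬incident⇒≡0 C w ¬inc with C w
  ... | zero  = refl
  ... | suc _ = ⊥-elim (¬inc (s≤s z≤n))

  boundary-resp : ∀ C D {w} → C w ≡ D w → Boundary C w → Boundary D w
  boundary-resp C D {w} eq = subst (λ n → 0 < n × (T (ex w) ⊎ n < R w)) eq

  -- C = A ∪ B for edge-disjoint clusters A and B inside the tree.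
  module Join (A B C : Vertex → ℕ) (C≡A⊕B : ∀ w → C w ≡ A w + B w) (C≤R : ∀ w → C w ≤ R w) where

    A≤C : ∀ w → A w ≤ C w
    A≤C w = subst (A w ≤_) (sym (C≡A⊕B w)) (m≤m+n (A w) (B w))

    B≤C : ∀ w → B w ≤ C w
    B≤C w = subst (B w ≤_) (sym (C≡A⊕B w)) (m≤n+m (B w) (A w))

    incidentˡ : ∀ {w} → Incident A w → Incident C w
    incidentˡ {w} a = <-≤-trans a (A≤C w)

    incidentʳ : ∀ {w} → Incident B w → Incident C w
    incidentʳ {w} b = <-≤-trans b (B≤C w)

    incident-split : ∀ {w} → Incident C w → Incident A w ⊎ Incident B w
    incident-split {w} c with A w | C≡A⊕B w
    ... | suc _ | _    = inj₁ (s≤s z≤n)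
    ... | zero  | C≡B = inj₂ (subst (0 <_) C≡B c)

    shared-boundaryˡ : ∀ {w} → Incident A w → Incident B w → Boundary A w
    shared-boundaryˡ {w} a b = a , inj₂ (<-≤-trans (m<m+n (A w) b) (subst (_≤ R w) (C≡A⊕B w) (C≤R w)))

    shared-boundaryʳ : ∀ {w} → Incident A w → Incident B w → Boundary B w
    shared-boundaryʳ {w} a b =
      b , inj₂ (<-≤-trans (m<m+n (B w) a) (subst (_≤ R w) (trans (C≡A⊕B w) (+-comm (A w) (B w))) (C≤R w)))

    boundaryˡ-of : ∀ {w} → Boundary C w → Incident A w → Boundary A w
    boundaryˡ-of (_ , inj₁ exposed) a = a , inj₁ exposed
    boundaryˡ-of {w} (_ , inj₂ outside) a = a , inj₂ (≤-<-trans (A≤C w) outside)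

    boundaryʳ-of : ∀ {w} → Boundary C w → Incident B w → Boundary B w
    boundaryʳ-of (_ , inj₁ exposed) b = b , inj₁ exposed
    boundaryʳ-of {w} (_ , inj₂ outside) b = b , inj₂ (≤-<-trans (B≤C w) outside)

    boundaryˡ-lift : ∀ {w} → Boundary A w → ¬ Incident B w → Boundary C w
    boundaryˡ-lift {w} a ¬b =
      boundary-resp A C (sym (trans (C≡A⊕B w) (trans (cong (A w +_) (¬incident⇒≡0 B w ¬b)) (+-comm (A w) 0)))) a

    boundaryʳ-lift : ∀ {w} → Boundary B w → ¬ Incident A w → Boundary C w
    boundaryʳ-lift {w} b ¬a = boundary-resp B C (sym (trans (C≡A⊕B w) (cong (_+ B w) (¬incident⇒≡0 A w ¬a)))) b

    boundary-beyond-unique : ∀ {c q w₁ w₂} → JoinedAt A B c → Boundary A q → q ≢ c →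
      AtMost₂ (Boundary B) → AtMost₂ (Boundary C) → Boundary C w₁ → Boundary C w₂ → w₁ ≢ w₂ →
      w₁ ≡ c ⊎ (Incident B w₁ × ¬ Incident A w₁) → w₂ ≡ c ⊎ (Incident B w₂ × ¬ Incident A w₂) → ⊥
    boundary-beyond-unique {c} {q} {w₁} {w₂} (Ac , Bc , onlyC) Aq q≢c amB amC C₁ C₂ w₁≢w₂ = both
      where
      withC : ∀ {w} → Boundary C c → Boundary C w → c ≢ w → ¬ Incident A w → ⊥
      withC Cc Cw c≢w ¬Aw with incident? B q
      ... | yes Bq = q≢c (onlyC q (proj₁ Aq) Bq)
      ... | no ¬Bq with AtMost₂-other amC Cc Cw c≢w (boundaryˡ-lift Aq ¬Bq)
      ...   | inj₁ q≡c  = q≢c q≡c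
      ...   | inj₂ refl = ¬Aw (proj₁ Aq)
      both : w₁ ≡ c ⊎ (Incident B w₁ × ¬ Incident A w₁) → w₂ ≡ c ⊎ (Incident B w₂ × ¬ Incident A w₂) → ⊥
      both (inj₁ refl) (inj₁ refl) = w₁≢w₂ refl
      both (inj₁ refl) (inj₂ (_ , ¬A₂)) = withC C₁ C₂ w₁≢w₂ ¬A₂
      both (inj₂ (_ , ¬A₁)) (inj₁ refl) = withC C₂ C₁ (w₁≢w₂ ∘ sym) ¬A₁
      both (inj₂ (B₁ , ¬A₁)) (inj₂ (B₂ , ¬A₂)) =
        AtMost₂-¬three amB (boundaryʳ-of C₁ B₁) (boundaryʳ-of C₂ B₂) (shared-boundaryʳ Ac Bc) w₁≢w₂
          (λ { refl → ¬A₁ Ac }) (λ { refl → ¬A₂ Ac })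

  -- rotate_up(u) for y = u ∪ a and z = y ∪ b: it is allowed iff ValidUnion a b.
  module Rotation (u a b y z : Vertex → ℕ) (y≡u⊕a : ∀ w → y w ≡ u w + a w) (z≡y⊕b : ∀ w → z w ≡ y w + b w)
                  (z≤R : ∀ w → z w ≤ R w) where

    z≡u⊕ab : ∀ w → z w ≡ u w + (a ⊕ b) w
    z≡u⊕ab w = trans (z≡y⊕b w) (trans (cong (_+ b w) (y≡u⊕a w)) (+-assoc (u w) (a w) (b w)))

    module Z  = Join y b z z≡y⊕b z≤R
    module Y  = Join u a y y≡u⊕a (λ w → ≤-trans (Z.A≤C w) (z≤R w))
    module Z′ = Join u (a ⊕ b) z z≡u⊕ab z≤R
    module AB = Join a b (a ⊕ b) (λ _ → refl) (λ w → ≤-trans (Z′.B≤C w) (z≤R w))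

    boundary-ab : ∀ {w} → Boundary (a ⊕ b) w → Boundary z w ⊎ Incident u w
    boundary-ab {w} bd with incident? u w
    ... | yes uw = inj₂ uw
    ... | no ¬uw = inj₁ (Z′.boundaryʳ-lift bd ¬uw)

    boundary-ab-cover : ∀ {cy cz} → JoinedAt u a cy → JoinedAt y b cz → Incident a cz →
      ∀ {w} → Boundary (a ⊕ b) w → Boundary z w ⊎ w ≡ cy
    boundary-ab-cover {cy} (_ , _ , onlyY) (_ , _ , onlyZ) acz {w} bd = Sum.map₂ meet (boundary-ab bd)
      where
      meet : Incident u w → w ≡ cy
      meet uw with AB.incident-split (proj₁ bd)
      ... | inj₁ aw = onlyY w uw aw
      ... | inj₂ bw with refl ← onlyZ w (Y.incidentˡ uw) bw = onlyY w uw acz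

    points-valid : ∀ {cy cz} → JoinedAt u a cy → JoinedAt y b cz →
      AtMost₁ (Boundary u) → AtMost₁ (Boundary z) → ValidUnion a b
    points-valid {cy} {cz} (ucy , acy , _) (ycz , bcz , _) (vu , onlyU) (vz , onlyZ) =
      adjacent , vz , vu ,
      λ w bd → Sum.map (onlyZ w) (λ uw → onlyU w (Z′.shared-boundaryˡ uw (proj₁ bd))) (boundary-ab bd)
      where
      adjacent : Adjacent a b
      adjacent with Y.incident-split ycz
      ... | inj₂ acz = cz , acz , bcz
      ... | inj₁ ucz with refl ← trans (onlyU cz (Z′.shared-boundaryˡ ucz (AB.incidentʳ bcz)))
                                       (sym (onlyU cy (Z′.shared-boundaryˡ ucy (AB.incidentˡ acy)))) = cy , acy , bcz

    zigzig-point-valid : ∀ {cy cz} → JoinedAt u a cy → JoinedAt y b cz → Incident a cz →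
      AtMost₁ (Boundary z) → ValidUnion a b
    zigzig-point-valid {cy} {cz} joinY joinZ@(_ , bcz , _) acz (vz , onlyZ) =
      (cz , acz , bcz) , vz , cy , λ w bd → Sum.map₁ (onlyZ w) (boundary-ab-cover joinY joinZ acz bd)

    zigzig-path-core : ∀ {cy cz} → JoinedAt u a cy → JoinedAt y b cz → Outermost ex R y a cy cz →
      TwoDistinct (Boundary y) → AtMost₂ (Boundary a) → AtMost₂ (Boundary b) → AtMost₂ (Boundary z) →
      ∀ {w₁ w₂} → Boundary z w₁ → Boundary z w₂ → Incident (a ⊕ b) w₁ → Incident (a ⊕ b) w₂ →
      w₁ ≢ w₂ → w₁ ≢ cy → w₂ ≢ cy → ⊥
    zigzig-path-core {cy} {cz} (ucy , acy , _) joinZ@(ycz , bcz , onlyZ) (_ , acz , outermost) pathY amA amB amZ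
                     {w₁} {w₂} z₁ z₂ ab₁ ab₂ w₁≢w₂ w₁≢cy w₂≢cy with cz ≟ cy
    ... | yes refl = AtMost₂-¬three amB (Z.boundaryʳ-of z₁ (in-b z₁ ab₁ w₁≢cy)) (Z.boundaryʳ-of z₂ (in-b z₂ ab₂ w₂≢cy))
                       (Z.shared-boundaryʳ ycz bcz) w₁≢w₂ w₁≢cy w₂≢cy
      where
      in-b : ∀ {w} → Boundary z w → Incident (a ⊕ b) w → w ≢ cy → Incident b w
      in-b {w} zw abw w≢cy with AB.incident-split abw
      ... | inj₂ bw = bw
      ... | inj₁ aw = ⊥-elim (outermost refl w (Z.boundaryˡ-of zw (Y.incidentʳ aw)) w≢cy
                               (Y.boundaryʳ-of (Z.boundaryˡ-of zw (Y.incidentʳ aw)) aw))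
    ... | no cz≢cy with q , yq , q≢cz ← TwoDistinct-avoid pathY cz =
      Z.boundary-beyond-unique joinZ yq q≢cz amB amZ z₁ z₂ w₁≢w₂ (beyond z₁ ab₁ w₁≢cy) (beyond z₂ ab₂ w₂≢cy)
      where
      beyond : ∀ {w} → Boundary z w → Incident (a ⊕ b) w → w ≢ cy → w ≡ cz ⊎ (Incident b w × ¬ Incident y w)
      beyond {w} zw abw w≢cy with incident? a w
      ... | yes aw with w ≟ cz
      ...   | yes w≡cz = inj₁ w≡cz
      ...   | no w≢cz = ⊥-elim (AtMost₂-¬three amA (Y.shared-boundaryʳ ucy acy) (AB.shared-boundaryˡ acz bcz)
                          (Y.boundaryʳ-of (Z.boundaryˡ-of zw (Y.incidentʳ aw)) aw)
                          (cz≢cy ∘ sym) (w≢cy ∘ sym) (w≢cz ∘ sym))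
      beyond {w} zw abw w≢cy | no ¬aw with AB.incident-split abw
      ... | inj₁ aw = ⊥-elim (¬aw aw)
      ... | inj₂ bw with incident? y w
      ...   | yes yw = inj₁ (onlyZ w yw bw)
      ...   | no ¬yw = inj₂ (bw , ¬yw)

    zigzig-path-valid : ∀ {cy cz} → JoinedAt u a cy → JoinedAt y b cz → Outermost ex R y a cy cz →
      TwoDistinct (Boundary y) → AtMost₂ (Boundary a) → AtMost₂ (Boundary b) → AtMost₂ (Boundary z) → ValidUnion a b
    zigzig-path-valid {cy} {cz} joinY joinZ@(_ , bcz , _) out@(_ , acz , _) pathY amA amB amZ@(z₁ , z₂ , onlyZ) =
      (cz , acz , bcz) , AtMost₂-of-three (boundary? (a ⊕ b)) z₁ z₂ cy cover ¬three
      where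
      cover : ∀ w → Boundary (a ⊕ b) w → w ≡ z₁ ⊎ w ≡ z₂ ⊎ w ≡ cy
      cover w bd = [ Sum.map₂ inj₁ ∘ onlyZ w , inj₂ ∘ inj₂ ]′ (boundary-ab-cover joinY joinZ acz bd)
      z-boundary : ∀ {w} → Boundary (a ⊕ b) w → w ≢ cy → Boundary z w
      z-boundary bd w≢cy = [ (λ zw → zw) , ⊥-elim ∘ w≢cy ]′ (boundary-ab-cover joinY joinZ acz bd)
      ¬three : Boundary (a ⊕ b) z₁ → Boundary (a ⊕ b) z₂ → Boundary (a ⊕ b) cy → z₁ ≢ z₂ → z₁ ≢ cy → z₂ ≢ cy → ⊥
      ¬three bd₁ bd₂ _ z₁≢z₂ z₁≢cy z₂≢cy = zigzig-path-core joinY joinZ out pathY amA amB amZ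
        (z-boundary bd₁ z₁≢cy) (z-boundary bd₂ z₂≢cy) (proj₁ bd₁) (proj₁ bd₂) z₁≢z₂ z₁≢cy z₂≢cy

  -- The second rotation of a zig-zag step: p = x ∪ s below g = b₁ ∪ p below gg = g ∪ b₂,
  -- where after rotate_up(s) the node x ∪ b₁ is rotated up, which needs s ∪ b₂.
  module DoubleRotation (x s b₁ b₂ p g gg : Vertex → ℕ) (p≡x⊕s : ∀ w → p w ≡ x w + s w)
    (g≡b₁⊕p : ∀ w → g w ≡ b₁ w + p w) (gg≡g⊕b₂ : ∀ w → gg w ≡ g w + b₂ w) (gg≤R : ∀ w → gg w ≤ R w)
    {cp cg cgg : Vertex} (joinP : JoinedAt x s cp) (joinG : JoinedAt b₁ p cg) (joinGG : JoinedAt g b₂ cgg)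
    (outG : Outermost ex R g p cg cgg) (outP : Outermost ex R p x cp cg)
    (pathP : TwoDistinct (Boundary p)) (amX : AtMost₂ (Boundary x)) (amP : AtMost₂ (Boundary p)) where

    gg≡xb₁⊕sb₂ : ∀ w → gg w ≡ (x ⊕ b₁) w + (s ⊕ b₂) w
    gg≡xb₁⊕sb₂ w = trans (gg≡g⊕b₂ w) (trans (cong (_+ b₂ w) (trans (g≡b₁⊕p w) (cong (b₁ w +_) (p≡x⊕s w))))
      (solve 4 (λ x s b₁ b₂ → (b₁ :+ (x :+ s)) :+ b₂ := (x :+ b₁) :+ (s :+ b₂)) refl (x w) (s w) (b₁ w) (b₂ w)))

    module GG  = Join g b₂ gg gg≡g⊕b₂ gg≤R
    module G   = Join b₁ p g g≡b₁⊕p (λ w → ≤-trans (GG.A≤C w) (gg≤R w))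
    module P   = Join x s p p≡x⊕s (λ w → ≤-trans (G.B≤C w) (≤-trans (GG.A≤C w) (gg≤R w)))
    module GG′ = Join (x ⊕ b₁) (s ⊕ b₂) gg gg≡xb₁⊕sb₂ gg≤R
    module XB  = Join x b₁ (x ⊕ b₁) (λ _ → refl) (λ w → ≤-trans (GG′.A≤C w) (gg≤R w))
    module SB  = Join s b₂ (s ⊕ b₂) (λ _ → refl) (λ w → ≤-trans (GG′.B≤C w) (gg≤R w))

    x∩s⊆cp : ∀ w → Incident x w → Incident s w → w ≡ cp
    x∩s⊆cp = proj₂ (proj₂ joinP)

    b₁∩p⊆cg : ∀ w → Incident b₁ w → Incident p w → w ≡ cg
    b₁∩p⊆cg = proj₂ (proj₂ joinG)

    g∩b₂⊆cgg : ∀ w → Incident g w → Incident b₂ w → w ≡ cgg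
    g∩b₂⊆cgg = proj₂ (proj₂ joinGG)

    pcg : Boundary p cg
    pcg = proj₁ outP

    xcg : Incident x cg
    xcg = proj₁ (proj₂ outP)

    pcgg : Boundary p cgg
    pcgg = G.boundaryʳ-of (proj₁ outG) (proj₁ (proj₂ outG))

    other-end : Σ Vertex λ r → Boundary p r × r ≢ cg
    other-end = TwoDistinct-avoid pathP cg

    cgg≢cg : cgg ≢ cg
    cgg≢cg cgg≡cg with r , pr , r≢cg ← other-end =
      proj₂ (proj₂ outG) cgg≡cg r (G.boundaryʳ-lift pr (λ b₁r → r≢cg (b₁∩p⊆cg r b₁r (proj₁ pr)))) r≢cg pr

    scgg : Incident s cgg
    scgg with r , pr , r≢cg ← other-end
         with refl ← [ ⊥-elim ∘ cgg≢cg , sym ]′ (AtMost₂-other amP pcg pr (r≢cg ∘ sym) pcgg)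
         with incident? s r
    ... | yes sr = sr
    -- otherwise the end r of p lies in x only, and x has the three boundary vertices r, cg, cp
    ... | no ¬sr = ⊥-elim (AtMost₂-¬three amX xr (P.boundaryˡ-of pcg xcg) (P.shared-boundaryˡ xcp scp) r≢cg r≢cp cg≢cp)
      where
      xcp : Incident x cp
      xcp = proj₁ joinP
      scp : Incident s cp
      scp = proj₁ (proj₂ joinP)
      r≢cp : r ≢ cp
      r≢cp refl = ¬sr scp
      xr : Boundary x r
      xr = P.boundaryˡ-of pr ([ (λ x-r → x-r) , ⊥-elim ∘ ¬sr ]′ (P.incident-split (proj₁ pr)))
      cg≢cp : cg ≢ cp
      cg≢cp cg≡cp = proj₂ (proj₂ outP) cg≡cp r pr r≢cp xr

    xb₁∩sb₂⊆cp : ∀ {w} → Incident (x ⊕ b₁) w → Incident (s ⊕ b₂) w → w ≡ cp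
    xb₁∩sb₂⊆cp {w} xb₁w sb₂w with XB.incident-split xb₁w | SB.incident-split sb₂w
    ... | inj₁ xw  | inj₁ sw  = x∩s⊆cp w xw sw
    ... | inj₁ xw  | inj₂ b₂w with refl ← g∩b₂⊆cgg w (G.incidentʳ (P.incidentˡ xw)) b₂w = x∩s⊆cp w xw scgg
    ... | inj₂ b₁w | inj₁ sw  with refl ← b₁∩p⊆cg w b₁w (P.incidentʳ sw) = x∩s⊆cp w xcg sw
    ... | inj₂ b₁w | inj₂ b₂w with refl ← g∩b₂⊆cgg w (G.incidentˡ b₁w) b₂w =
      ⊥-elim (cgg≢cg (b₁∩p⊆cg w b₁w (proj₁ pcgg)))

    boundary-sb₂-cover : ∀ {w} → Boundary (s ⊕ b₂) w → Boundary gg w ⊎ w ≡ cp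
    boundary-sb₂-cover {w} bd with incident? (x ⊕ b₁) w
    ... | yes xb₁w = inj₂ (xb₁∩sb₂⊆cp xb₁w (proj₁ bd))
    ... | no ¬xb₁w = inj₁ (GG′.boundaryʳ-lift bd ¬xb₁w)

    zigzag-core : TwoDistinct (Boundary g) ⊎ AtMost₁ (Boundary gg) →
      AtMost₂ (Boundary b₂) → AtMost₂ (Boundary g) → AtMost₂ (Boundary gg) →
      ∀ {w₁ w₂} → Boundary gg w₁ → Boundary gg w₂ → Incident (s ⊕ b₂) w₁ → Incident (s ⊕ b₂) w₂ →
      w₁ ≢ w₂ → w₁ ≢ cp → w₂ ≢ cp → ⊥
    zigzag-core (inj₂ pointGG) _ _ _ gg₁ gg₂ _ _ w₁≢w₂ _ _ = AtMost₁-¬two pointGG gg₁ gg₂ w₁≢w₂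
    zigzag-core (inj₁ pathG) amB₂ amG amGG gg₁ gg₂ sb₁ sb₂ w₁≢w₂ w₁≢cp w₂≢cp
      with q , gq , q≢cgg ← TwoDistinct-avoid pathG cgg =
      GG.boundary-beyond-unique joinGG gq q≢cgg amB₂ amGG gg₁ gg₂ w₁≢w₂ (beyond gg₁ sb₁ w₁≢cp) (beyond gg₂ sb₂ w₂≢cp)
      where
      beyond : ∀ {w} → Boundary gg w → Incident (s ⊕ b₂) w → w ≢ cp → w ≡ cgg ⊎ (Incident b₂ w × ¬ Incident g w)
      beyond {w} ggw sbw w≢cp with incident? g w
      ... | no ¬gw = inj₂ ([ ⊥-elim ∘ ¬gw ∘ G.incidentʳ ∘ P.incidentʳ , (λ b₂w → b₂w) ]′ (SB.incident-split sbw) , ¬gw)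
      ... | yes gw with AtMost₂-other amG (proj₁ outG) gq (q≢cgg ∘ sym) (GG.boundaryˡ-of ggw gw)
      ...   | inj₁ w≡cgg = inj₁ w≡cgg
      ...   | inj₂ refl with SB.incident-split sbw
      ...     | inj₂ b₂w = ⊥-elim (q≢cgg (g∩b₂⊆cgg w gw b₂w))
      ...     | inj₁ sw with AtMost₂-other amP pcg pcgg (cgg≢cg ∘ sym) (G.boundaryʳ-of gq (P.incidentʳ sw))
      ...       | inj₁ refl = ⊥-elim (w≢cp (x∩s⊆cp w xcg sw))
      ...       | inj₂ w≡cgg = ⊥-elim (q≢cgg w≡cgg)

    zigzag-valid : TwoDistinct (Boundary g) ⊎ AtMost₁ (Boundary gg) →
      AtMost₂ (Boundary b₂) → AtMost₂ (Boundary g) → AtMost₂ (Boundary gg) → ValidUnion s b₂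
    zigzag-valid pathG⊎pointGG amB₂ amG amGG@(gg₁ , gg₂ , onlyGG) =
      (cgg , scgg , proj₁ (proj₂ joinGG)) ,
      AtMost₂-of-three (boundary? (s ⊕ b₂)) gg₁ gg₂ cp cover ¬three
      where
      cover : ∀ w → Boundary (s ⊕ b₂) w → w ≡ gg₁ ⊎ w ≡ gg₂ ⊎ w ≡ cp
      cover w bd = [ Sum.map₂ inj₁ ∘ onlyGG w , inj₂ ∘ inj₂ ]′ (boundary-sb₂-cover bd)
      gg-boundary : ∀ {w} → Boundary (s ⊕ b₂) w → w ≢ cp → Boundary gg w
      gg-boundary bd w≢cp = [ (λ ggw → ggw) , ⊥-elim ∘ w≢cp ]′ (boundary-sb₂-cover bd)
      ¬three : Boundary (s ⊕ b₂) gg₁ → Boundary (s ⊕ b₂) gg₂ → Boundary (s ⊕ b₂) cp →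
        gg₁ ≢ gg₂ → gg₁ ≢ cp → gg₂ ≢ cp → ⊥
      ¬three bd₁ bd₂ _ gg₁≢gg₂ gg₁≢cp gg₂≢cp = zigzag-core pathG⊎pointGG amB₂ amG amGG
        (gg-boundary bd₁ gg₁≢cp) (gg-boundary bd₂ gg₂≢cp) (proj₁ bd₁) (proj₁ bd₂) gg₁≢gg₂ gg₁≢cp gg₂≢cp

ValidUnion-resp : ∀ ex {R R′ a a′ b b′ : Vertex → ℕ} → (∀ w → R′ w ≡ R w) → (∀ w → a′ w ≡ a w) →
  (∀ w → b′ w ≡ b w) → Clusters.ValidUnion ex R a b → Clusters.ValidUnion ex R′ a′ b′
ValidUnion-resp ex {R} {R′} {a} {a′} {b} {b′} R′≡R a′≡a b′≡b ((v , av , bv) , v₁ , v₂ , only) =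
  (v , subst (0 <_) (sym (a′≡a v)) av , subst (0 <_) (sym (b′≡b v)) bv) , v₁ , v₂ , λ w bd → only w (transport bd)
  where
  transport : ∀ {w} → BoundaryOf ex R′ (a′ ⊕ b′) w → BoundaryOf ex R (a ⊕ b) w
  transport {w} = subst₂ (λ r c → 0 < c × (T (ex w) ⊎ c < r)) (R′≡R w) (cong₂ _+_ (a′≡a w) (b′≡b w))

allowed-if-valid : ∀ ex rt a b → Clusters.ValidUnion ex (deg rt) (deg a) (deg b) → allowed ex rt a b ≡ true
allowed-if-valid ex rt a b (adjacent , atMost₂) = allowed-intro ex rt a b adjacent atMost₂

flipSide-involutive : ∀ s → flipSide (flipSide s) ≡ s
flipSide-involutive left  = refl
flipSide-involutive right = refl

sameSide-true : ∀ {a b} → sameSide a b ≡ true → a ≡ b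
sameSide-true {left}  {left}  _ = refl
sameSide-true {right} {right} _ = refl

sameSide-false : ∀ {a b} → sameSide a b ≡ false → a ≡ flipSide b
sameSide-false {left}  {right} _ = refl
sameSide-false {right} {left}  _ = refl

labels-node : ∀ i {A A′ B B′} → labels A ↭ labels A′ → labels B ↭ labels B′ →
  labels (node i A B) ↭ labels (node i A′ B′)
labels-node i A↭A′ B↭B′ = ↭-prep i (++⁺ A↭A′ B↭B′)

labels-swap : ∀ i A B → labels (node i A B) ↭ labels (node i B A)
labels-swap i A B = ↭-prep i (++-comm (labels A) (labels B))

labels-rev : ∀ t → labels (rev t) ↭ labels t
labels-rev (leaf i l r) = ↭-refl
labels-rev (node i L R) = ↭-trans (labels-node i (labels-rev R) (labels-rev L)) (labels-swap i R L)

labels-revIf : ∀ f t → labels (revIf f t) ↭ labels t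
labels-revIf false t = ↭-refl
labels-revIf true  t = labels-rev t

labels-ordered : ∀ i o A B → labels (ordered i o A B) ↭ labels (node i A B)
labels-ordered i false A B = ↭-refl
labels-ordered i true  A B = labels-swap i B A

labels-children : ∀ s i A B → labels (node i A B) ↭ labels (node i (child s A B) (child (flipSide s) A B))
labels-children left  i A B = ↭-refl
labels-children right i A B = labels-swap i A B

labels-rotate : ∀ iz iy u a b → labels (node iz u (node iy a b)) ↭ labels (node iz (node iy u a) b)
labels-rotate iz iy u a b = ↭-prep iz (↭-trans (shift iy (labels u) (labels a ++ labels b))
  (↭-reflexive (cong (iy ∷_) (sym (++-assoc (labels u) (labels a) (labels b))))))

get-labels : ∀ q t s → get q t ≡ just s → ∀ {n} → n ∈ labels s → n ∈ labels t
get-labels []          t            s refl m = m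
get-labels (left ∷ q)  (node i L R) s e    m = there (∈-++⁺ˡ (get-labels q L s e m))
get-labels (right ∷ q) (node i L R) s e    m = there (∈-++⁺ʳ (labels L) (get-labels q R s e m))

label∈labels : ∀ t → label t ∈ labels t
label∈labels (leaf i l r) = here refl
label∈labels (node i L R) = here refl

findPath-∉ : ∀ n t → n ∉ labels t → findPath n t ≡ nothing
findPath-∉ n (leaf i l r) n∉ rewrite ≢⇒≡ᵇ≡false (λ i≡n → n∉ (here (sym i≡n))) = refl
findPath-∉ n (node i L R) n∉
  rewrite ≢⇒≡ᵇ≡false (λ i≡n → n∉ (here (sym i≡n)))
        | findPath-∉ n L (λ m → n∉ (there (∈-++⁺ˡ m)))
        | findPath-∉ n R (λ m → n∉ (there (∈-++⁺ʳ (labels L) m))) = refl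

findPath-get : ∀ q t s → Unique (labels t) → get q t ≡ just s → findPath (label s) t ≡ just q
findPath-get [] (leaf i l r) s _ refl rewrite ≡ᵇ-refl i = refl
findPath-get [] (node i L R) s _ refl rewrite ≡ᵇ-refl i = refl
findPath-get (left ∷ q) (node i L R) s (i∉ ∷ u) e
  with uL , _ , _ ← Unique-++⁻ (labels L) u
  rewrite ≢⇒≡ᵇ≡false (lookup i∉ (∈-++⁺ˡ (get-labels q L s e (label∈labels s))))
        | findPath-get q L s uL e = refl
findPath-get (right ∷ q) (node i L R) s (i∉ ∷ u) e
  with _ , uR , disj ← Unique-++⁻ (labels L) u
  rewrite ≢⇒≡ᵇ≡false (lookup i∉ (∈-++⁺ʳ (labels L) (get-labels q R s e (label∈labels s))))
        | findPath-∉ (label s) L (λ m → disj (m , get-labels q R s e (label∈labels s)))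
        | findPath-get q R s uR e = refl

findPath⇒get : ∀ n t q → findPath n t ≡ just q → Σ TopTree λ s → get q t ≡ just s × label s ≡ n
findPath⇒get n (leaf i l r) q found with i ≡ᵇ n in i≡ᵇn
findPath⇒get n (leaf i l r) .[] refl | true = leaf i l r , refl , ≡ᵇ⇒≡ i n (subst T (sym i≡ᵇn) _)
findPath⇒get n (node i L R) q found with i ≡ᵇ n in i≡ᵇn
findPath⇒get n (node i L R) .[] refl | true = node i L R , refl , ≡ᵇ⇒≡ i n (subst T (sym i≡ᵇn) _)
... | false with findPath n L in inL
findPath⇒get n (node i L R) .(left ∷ q) refl | false | just q = findPath⇒get n L q inL
... | nothing with findPath n R in inR
findPath⇒get n (node i L R) .(right ∷ q) refl | false | nothing | just q = findPath⇒get n R q inR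

get-++ : ∀ q q′ t Z → get q t ≡ just Z → get (q ++ q′) t ≡ get q′ Z
get-++ []          q′ t            Z refl = refl
get-++ (left ∷ q)  q′ (node i L R) Z e    = get-++ q q′ L Z e
get-++ (right ∷ q) q′ (node i L R) Z e    = get-++ q q′ R Z e

get-∷ʳ : ∀ q s t i L R → get q t ≡ just (node i L R) → get (q ++ s ∷ []) t ≡ just (child s L R)
get-∷ʳ q left  t i L R e = get-++ q (left ∷ [])  t (node i L R) e
get-∷ʳ q right t i L R e = get-++ q (right ∷ []) t (node i L R) e

get-∷ʳ⁻ : ∀ q s t N → get (q ++ s ∷ []) t ≡ just N →
  Σ Label λ i → Σ TopTree λ L → Σ TopTree λ R → get q t ≡ just (node i L R) × child s L R ≡ N
get-∷ʳ⁻ []          left  (node i L R) N refl = i , L , R , refl , refl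
get-∷ʳ⁻ []          right (node i L R) N refl = i , L , R , refl , refl
get-∷ʳ⁻ (left ∷ q)  s     (node i L R) N e    = get-∷ʳ⁻ q s L N e
get-∷ʳ⁻ (right ∷ q) s     (node i L R) N e    = get-∷ʳ⁻ q s R N e

get-reverse-∷ : ∀ s r t i L R → get (reverse r) t ≡ just (node i L R) → get (reverse (s ∷ r)) t ≡ just (child s L R)
get-reverse-∷ s r t i L R e rewrite unfold-reverse s r = get-∷ʳ (reverse r) s t i L R e

get-reverse-∷⁻ : ∀ s r t N → get (reverse (s ∷ r)) t ≡ just N →
  Σ Label λ i → Σ TopTree λ L → Σ TopTree λ R → get (reverse r) t ≡ just (node i L R) × child s L R ≡ N
get-reverse-∷⁻ s r t N e rewrite unfold-reverse s r = get-∷ʳ⁻ (reverse r) s t N e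

get-grandchild : ∀ su sy rz t iz Z₁ Z₂ iy Y₁ Y₂ → get (reverse rz) t ≡ just (node iz Z₁ Z₂) →
  child sy Z₁ Z₂ ≡ node iy Y₁ Y₂ → get (reverse (su ∷ sy ∷ rz)) t ≡ just (child su Y₁ Y₂)
get-grandchild su sy rz t iz Z₁ Z₂ iy Y₁ Y₂ getZ y≡ =
  get-reverse-∷ su (sy ∷ rz) t iy Y₁ Y₂ (trans (get-reverse-∷ sy rz t iz Z₁ Z₂ getZ) (cong just y≡))

AllNodes-get : ∀ {P : TopTree → Set} q t s → AllNodes P t → get q t ≡ just s → P s
AllNodes-get []          (leaf i l r) s p       refl = p
AllNodes-get []          (node i L R) s (p , _) refl = p
AllNodes-get (left ∷ q)  (node i L R) s (_ , pL , _) e = AllNodes-get q L s pL e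
AllNodes-get (right ∷ q) (node i L R) s (_ , _ , pR) e = AllNodes-get q R s pR e

deg-get-≤ : ∀ q t s → get q t ≡ just s → ∀ w → deg s w ≤ deg t w
deg-get-≤ []          t            s refl w = ≤-refl
deg-get-≤ (left ∷ q)  (node i L R) s e    w = ≤-trans (deg-get-≤ q L s e w) (m≤m+n (deg L w) (deg R w))
deg-get-≤ (right ∷ q) (node i L R) s e    w = ≤-trans (deg-get-≤ q R s e w) (m≤n+m (deg R w) (deg L w))

get-replace-++ : ∀ q q′ t Z S → get q t ≡ just Z → get (q ++ q′) (replace q S t) ≡ get q′ S
get-replace-++ []          q′ t            Z S refl = refl
get-replace-++ (left ∷ q)  q′ (node i L R) Z S e    = get-replace-++ q q′ L Z S e
get-replace-++ (right ∷ q) q′ (node i L R) Z S e    = get-replace-++ q q′ R Z S e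

get-replace : ∀ q t Z S → get q t ≡ just Z → get q (replace q S t) ≡ just S
get-replace q t Z S e =
  subst (λ q′ → get q′ (replace q S t) ≡ just S) (++-identityʳ q) (get-replace-++ q [] t Z S e)

get-replace-prefix : ∀ q q′ t Z S → get q t ≡ just Z → get q (replace (q ++ q′) S t) ≡ just (replace q′ S Z)
get-replace-prefix []          q′ t            Z S refl = refl
get-replace-prefix (left ∷ q)  q′ (node i L R) Z S e    = get-replace-prefix q q′ L Z S e
get-replace-prefix (right ∷ q) q′ (node i L R) Z S e    = get-replace-prefix q q′ R Z S e

get-replace-parent : ∀ s rz t S i L R → get (reverse rz) t ≡ just (node i L R) →
  Σ TopTree λ L′ → Σ TopTree λ R′ → get (reverse rz) (replace (reverse (s ∷ rz)) S t) ≡ just (node i L′ R′) ×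
    child s L′ R′ ≡ S × child (flipSide s) L′ R′ ≡ child (flipSide s) L R
get-replace-parent left rz t S i L R e rewrite unfold-reverse left rz =
  S , R , get-replace-prefix (reverse rz) (left ∷ []) t (node i L R) S e , refl , refl
get-replace-parent right rz t S i L R e rewrite unfold-reverse right rz =
  L , S , get-replace-prefix (reverse rz) (right ∷ []) t (node i L R) S e , refl , refl

replace-replace : ∀ q q′ S S′ t → replace q S (replace (q ++ q′) S′ t) ≡ replace q S t
replace-replace []          q′ S S′ t            = refl
replace-replace (_ ∷ q)     q′ S S′ (leaf i l r) = refl
replace-replace (left ∷ q)  q′ S S′ (node i L R) = cong (λ L′ → node i L′ R) (replace-replace q q′ S S′ L)
replace-replace (right ∷ q) q′ S S′ (node i L R) = cong (node i L) (replace-replace q q′ S S′ R)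

labels-replace : ∀ q t Z S → get q t ≡ just Z → labels S ↭ labels Z → labels (replace q S t) ↭ labels t
labels-replace []          t            Z S refl S↭Z = S↭Z
labels-replace (left ∷ q)  (node i L R) Z S e    S↭Z = labels-node i (labels-replace q L Z S e S↭Z) ↭-refl
labels-replace (right ∷ q) (node i L R) Z S e    S↭Z = labels-node i ↭-refl (labels-replace q R Z S e S↭Z)

labels-child-replaced : ∀ s i {L R L′ R′ S} → child s L′ R′ ≡ S → child (flipSide s) L′ R′ ≡ child (flipSide s) L R →
  labels S ↭ labels (child s L R) → labels (node i L′ R′) ↭ labels (node i L R)
labels-child-replaced left  i refl refl S↭ = labels-node i S↭ ↭-refl
labels-child-replaced right i refl refl S↭ = labels-node i ↭-refl S↭

label-replace : ∀ q t Z S → get q t ≡ just Z → label S ≡ label Z → label (replace q S t) ≡ label t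
label-replace []          t            Z S refl eq = eq
label-replace (left ∷ q)  (node i L R) Z S _    _  = refl
label-replace (right ∷ q) (node i L R) Z S _    _  = refl

deg-replace : ∀ q t Z S → get q t ≡ just Z → (∀ w → deg S w ≡ deg Z w) → ∀ w → deg (replace q S t) w ≡ deg t w
deg-replace []          t            Z S refl eq w = eq w
deg-replace (left ∷ q)  (node i L R) Z S e    eq w = cong (_+ deg R w) (deg-replace q L Z S e eq w)
deg-replace (right ∷ q) (node i L R) Z S e    eq w = cong (deg L w +_) (deg-replace q R Z S e eq w)

localInfo-∉ : ∀ par n t → n ∉ labels t → localInfo par n t ≡ nothing
localInfo-∉ par n (leaf i l r) n∉ rewrite ≢⇒≡ᵇ≡false (λ i≡n → n∉ (here (sym i≡n))) = refl
localInfo-∉ par n (node i L R) n∉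
  rewrite ≢⇒≡ᵇ≡false (λ i≡n → n∉ (here (sym i≡n)))
        | localInfo-∉ (just i) n L (λ m → n∉ (there (∈-++⁺ˡ m)))
        | localInfo-∉ (just i) n R (λ m → n∉ (there (∈-++⁺ʳ (labels L) m))) = refl

localInfo-replace : ∀ q t Z S par n → get q t ≡ just Z → label S ≡ label Z → n ∉ labels Z → n ∉ labels S →
  localInfo par n (replace q S t) ≡ localInfo par n t
localInfo-replace [] t Z S par n refl _ n∉Z n∉S rewrite localInfo-∉ par n S n∉S | localInfo-∉ par n t n∉Z = refl
localInfo-replace (left ∷ q) (node i L R) Z S par n e eq n∉Z n∉S with i ≡ᵇ n
... | true  rewrite label-replace q L Z S e eq = refl
... | false rewrite localInfo-replace q L Z S (just i) n e eq n∉Z n∉S = refl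
localInfo-replace (right ∷ q) (node i L R) Z S par n e eq n∉Z n∉S with i ≡ᵇ n
... | true  rewrite label-replace q R Z S e eq = refl
... | false rewrite localInfo-replace q R Z S (just i) n e eq n∉Z n∉S = refl

AtDepth : Label → TopTree → ℕ → Set
AtDepth n t k = Σ (List Side) λ q → length q ≡ k × Σ TopTree λ s → get q t ≡ just s × label s ≡ n

at-root : ∀ t → AtDepth (label t) t 0
at-root t = [] , refl , t , refl , refl

at-child : ∀ s i A B {n k} → AtDepth n (child s A B) k → AtDepth n (node i A B) (suc k)
at-child left  i A B (q , len , s , e , lbl) = left ∷ q , cong suc len , s , e , lbl
at-child right i A B (q , len , s , e , lbl) = right ∷ q , cong suc len , s , e , lbl

at-ordered : ∀ i o A B {n k} → AtDepth n A k → AtDepth n (ordered i o A B) (suc k)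
at-ordered i false A B = at-child left i A B
at-ordered i true  A B = at-child right i B A

get-rev : ∀ q t → get (map flipSide q) (rev t) ≡ Maybe.map rev (get q t)
get-rev []          t            = refl
get-rev (_ ∷ q)     (leaf i l r) = refl
get-rev (left ∷ q)  (node i L R) = get-rev q L
get-rev (right ∷ q) (node i L R) = get-rev q R

label-rev : ∀ t → label (rev t) ≡ label t
label-rev (leaf i l r) = refl
label-rev (node i L R) = refl

at-revIf : ∀ f t {n k} → AtDepth n t k → AtDepth n (revIf f t) k
at-revIf false t at = at
at-revIf true  t (q , len , s , e , lbl) =
  map flipSide q , trans (length-map flipSide q) len , rev s , trans (get-rev q t) (cong (Maybe.map rev) e) ,
  trans (label-rev s) lbl

at-replace : ∀ q t Z S {n k} → get q t ≡ just Z → AtDepth n S k → AtDepth n (replace q S t) (length q + k)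
at-replace q t Z S e (q′ , len , s , e′ , lbl) =
  q ++ q′ , trans (length-++ q) (cong (length q +_) len) , s , trans (get-replace-++ q q′ t Z S e) e′ , lbl

at-depth : ∀ t {n k} → Unique (labels t) → AtDepth n t k → depth n t ≡ just k
at-depth t u (q , len , s , e , refl) rewrite findPath-get q t s u e = cong just len

deg-rev : ∀ t w → deg (rev t) w ≡ deg t w
deg-rev (leaf i l r) w with l ≡ᵇ w | r ≡ᵇ w
... | true  | true  = refl
... | true  | false = refl
... | false | true  = refl
... | false | false = refl
deg-rev (node i L R) w rewrite deg-rev L w | deg-rev R w = +-comm (deg R w) (deg L w)

deg-revIf : ∀ f t w → deg (revIf f t) w ≡ deg t w
deg-revIf false t w = refl
deg-revIf true  t w = deg-rev t w

deg-ordered : ∀ i o A B w → deg (ordered i o A B) w ≡ deg A w + deg B w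
deg-ordered i false A B w = refl
deg-ordered i true  A B w = +-comm (deg B w) (deg A w)

deg-children : ∀ s i A B w → deg (node i A B) w ≡ deg (child s A B) w + deg (child (flipSide s) A B) w
deg-children left  i A B w = refl
deg-children right i A B w = +-comm (deg A w) (deg B w)

label-ordered : ∀ i o A B → label (ordered i o A B) ≡ i
label-ordered i false A B = refl
label-ordered i true  A B = refl

IsCandidate : Label → Label → TopTree → TopTree → TopTree → TopTree → Set
IsCandidate iz iy u a b S = Σ Bool λ oz → Σ Bool λ oy → Σ Bool λ fu → Σ Bool λ fa → Σ Bool λ fb →
  S ≡ ordered iz oz (revIf fu u) (ordered iy oy (revIf fa a) (revIf fb b))

candidates-IsCandidate : ∀ iz iy u a b → All (IsCandidate iz iy u a b) (candidates iz iy u a b)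
candidates-IsCandidate iz iy u a b =
  concatMap⁺ (forBools λ oz → concatMap⁺ (forBools λ oy → concatMap⁺ (forBools λ fu →
    concatMap⁺ (forBools λ fa → map⁺ (forBools λ fb → oz , oy , fu , fa , fb , refl)))))
  where
  forBools : ∀ {P : Bool → Set} → (∀ o → P o) → All P bools
  forBools h = h false ∷ h true ∷ []
  concatMap⁺ : ∀ {A : Set} {P : TopTree → Set} {f : A → List TopTree} {xs} →
    All (All P ∘ f) xs → All P (concatMap f xs)
  concatMap⁺ ps = concat⁺ (map⁺ ps)

chooseFirst-All : ∀ {Q : TopTree → Set} p cs d → All Q cs → Q d → Q (chooseFirst p cs d)
chooseFirst-All p []       d []         qd = qd
chooseFirst-All p (c ∷ cs) d (qc ∷ qcs) qd with p c
... | true  = qc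
... | false = chooseFirst-All p cs d qcs qd

rotateUpAt-candidate : ∀ ex t rz sy su iz Z₁ Z₂ iy Y₁ Y₂ →
  get (reverse rz) t ≡ just (node iz Z₁ Z₂) → child sy Z₁ Z₂ ≡ node iy Y₁ Y₂ →
  allowed ex t (child (flipSide su) Y₁ Y₂) (child (flipSide sy) Z₁ Z₂) ≡ true →
  Σ TopTree λ S → IsCandidate iz iy (child su Y₁ Y₂) (child (flipSide su) Y₁ Y₂) (child (flipSide sy) Z₁ Z₂) S ×
    rotateUpAt ex t (su ∷ sy ∷ rz) ≡ just (replace (reverse rz) S t)
rotateUpAt-candidate ex t rz sy su iz Z₁ Z₂ iy Y₁ Y₂ getZ Y≡ ok rewrite getZ | Y≡ | ok =
  chooseFirst-All {Q = Rotated} (orientedAllᵇ ex t) (List.map (λ c → replace (reverse rz) c t) (candidates iz iy u a b))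
    (replace (reverse rz) (node iz u (node iy a b)) t)
    (map⁺ (All.map (λ {S} isC → S , isC , refl) (candidates-IsCandidate iz iy u a b)))
    (node iz u (node iy a b) , (false , false , false , false , false , refl) , refl)
  where
  u a b : TopTree
  u = child su Y₁ Y₂
  a = child (flipSide su) Y₁ Y₂
  b = child (flipSide sy) Z₁ Z₂
  Rotated : TopTree → Set
  Rotated T = Σ TopTree λ S → IsCandidate iz iy u a b S × just T ≡ just (replace (reverse rz) S t)

-- z = node iz Z₁ Z₂ with y = node iy Y₁ Y₂ on side sy, and rotate_up(u) for u on side su of y.
module RotationSite (iz : Label) (Z₁ Z₂ : TopTree) (sy : Side) (iy : Label) (Y₁ Y₂ : TopTree) (su : Side)
                    (y≡ : child sy Z₁ Z₂ ≡ node iy Y₁ Y₂) where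

  z y u a b : TopTree
  z = node iz Z₁ Z₂
  y = node iy Y₁ Y₂
  u = child su Y₁ Y₂
  a = child (flipSide su) Y₁ Y₂
  b = child (flipSide sy) Z₁ Z₂

  deg-y : ∀ w → deg y w ≡ deg u w + deg a w
  deg-y = deg-children su iy Y₁ Y₂

  deg-z : ∀ w → deg z w ≡ deg y w + deg b w
  deg-z w = trans (deg-children sy iz Z₁ Z₂ w) (cong (λ c → deg c w + deg b w) y≡)

  labels-z : labels (node iz (node iy u a) b) ↭ labels z
  labels-z = ↭-sym (↭-trans (labels-children sy iz Z₁ Z₂)
    (subst (λ c → labels (node iz c b) ↭ labels (node iz (node iy u a) b)) (sym y≡)
      (labels-node iz {A = y} {A′ = node iy u a} {B = b} {B′ = b} (labels-children su iy Y₁ Y₂) ↭-refl)))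

  labels-candidate : ∀ {S} → IsCandidate iz iy u a b S → labels S ↭ labels z
  labels-candidate (oz , oy , fu , fa , fb , refl) =
    ↭-trans (labels-ordered iz oz _ _)
      (↭-trans (labels-node iz {A = revIf fu u} {A′ = u} {B = ordered iy oy (revIf fa a) (revIf fb b)} {B′ = node iy a b}
                 (labels-revIf fu u)
                 (↭-trans (labels-ordered iy oy _ _)
                   (labels-node iy {A = revIf fa a} {A′ = a} {B = revIf fb b} {B′ = b}
                     (labels-revIf fa a) (labels-revIf fb b))))
        (↭-trans (labels-rotate iz iy u a b) labels-z))

  deg-candidate : ∀ {S} → IsCandidate iz iy u a b S → ∀ w → deg S w ≡ deg z w
  deg-candidate (oz , oy , fu , fa , fb , refl) w
    rewrite deg-ordered iz oz (revIf fu u) (ordered iy oy (revIf fa a) (revIf fb b)) w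
          | deg-ordered iy oy (revIf fa a) (revIf fb b) w
          | deg-revIf fu u w | deg-revIf fa a w | deg-revIf fb b w
          | deg-z w | deg-y w = sym (+-assoc (deg u w) (deg a w) (deg b w))

  label-candidate : ∀ {S} → IsCandidate iz iy u a b S → label S ≡ iz
  label-candidate (oz , _ , _ , _ , _ , refl) = label-ordered iz oz _ _

  at-candidate : ∀ {S} → IsCandidate iz iy u a b S → ∀ {n k} → AtDepth n u k → AtDepth n S (suc k)
  at-candidate (oz , _ , fu , _ , _ , refl) at = at-ordered iz oz (revIf fu u) _ (at-revIf fu u at)

candidate-view : ∀ {iz iy u a b S} → IsCandidate iz iy u a b S →
  Σ TopTree λ Y₁ → Σ TopTree λ Y₂ → Σ Side λ s → S ≡ node iz Y₁ Y₂ × label (child s Y₁ Y₂) ≡ iy ×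
    (∀ {n k} → AtDepth n a k → AtDepth n (child s Y₁ Y₂) (suc k)) × (∀ w → deg (child (flipSide s) Y₁ Y₂) w ≡ deg u w)
candidate-view {iz} {iy} {u} {a} {b} (false , oy , fu , fa , fb , refl) =
  revIf fu u , ordered iy oy (revIf fa a) (revIf fb b) , right , refl , label-ordered iy oy _ _ ,
  (λ at → at-ordered iy oy (revIf fa a) _ (at-revIf fa a at)) , deg-revIf fu u
candidate-view {iz} {iy} {u} {a} {b} (true , oy , fu , fa , fb , refl) =
  ordered iy oy (revIf fa a) (revIf fb b) , revIf fu u , left , refl , label-ordered iy oy _ _ ,
  (λ at → at-ordered iy oy (revIf fa a) _ (at-revIf fa a at)) , deg-revIf fu u

-- The node returned at depth e, with x at depth m below it, as the theorem requires.
ReturnDepths : ℕ → ℕ → ℕ → Set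
ReturnDepths d e m = e + m ≡ d ∸ 1 × d ∸ 5 ≤ e × e ≤ d ∸ 2

return-grandparent : ∀ L k → k ≤ 2 → ReturnDepths (3 + k + L) (suc L) (suc k)
return-grandparent L k k≤2 =
  cong suc (trans (+-suc L k) (cong suc (+-comm L k))) ,
  ≤-trans (∸-monoˡ-≤ 2 (+-monoˡ-≤ L k≤2)) (n≤1+n L) ,
  s≤s (m≤n+m L k)

return-great-grandparent : ∀ L k → k ≤ 2 → ReturnDepths (3 + k + L) L (suc (suc k))
return-great-grandparent L k k≤2 =
  trans (+-suc L (suc k)) (cong suc (trans (+-suc L k) (cong suc (+-comm L k)))) ,
  ∸-monoˡ-≤ 2 (+-monoˡ-≤ L k≤2) ,
  ≤-trans (m≤n+m L k) (n≤1+n (k + L))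

module Replacement (ex : Exposure) (t : TopTree) (uniq : Unique (labels t)) (x : Label) where

  GoodResult : ℕ → Result → Set
  GoodResult d r = Σ TopTree λ t′ → Σ Label λ x′ →
    r ≡ ret t′ x′ × depth x t′ ≡ just (d ∸ 1) ×
    (Σ ℕ λ e → depth x′ t′ ≡ just e × d ∸ 5 ≤ e × e ≤ d ∸ 2) ×
    (∀ n → Modified t t′ n → n ∈ subtreeLabels x′ t′)

  replacement-good : ∀ {d} q W S {m} → get q t ≡ just W → labels S ↭ labels W → label S ≡ label W →
    AtDepth x S m → ReturnDepths d (length q) m → GoodResult d (ret (replace q S t) (label W))
  replacement-good {d} q W S getW S↭W lbl atS (x-depth , lower , upper) =
    t′ , label W , refl , trans (at-depth t′ uniq′ (at-replace q t W S getW atS)) (cong just x-depth) ,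
    (length q , W-depth , lower , upper) , modified
    where
    t′ : TopTree
    t′ = replace q S t
    uniq′ : Unique (labels t′)
    uniq′ = Unique-resp-↭ (↭-sym (labels-replace q t W S getW S↭W)) uniq
    get-S : get q t′ ≡ just S
    get-S = get-replace q t W S getW
    W-depth : depth (label W) t′ ≡ just (length q)
    W-depth = trans (at-depth t′ uniq′ (at-replace q t W S getW (subst (λ l → AtDepth l S 0) lbl (at-root S))))
                    (cong just (+-identityʳ (length q)))
    subtree-W : subtreeLabels (label W) t′ ≡ labels S
    subtree-W rewrite sym lbl | findPath-get q t′ S uniq′ get-S | get-S = refl
    modified : ∀ n → Modified t t′ n → n ∈ subtreeLabels (label W) t′
    modified n changed with n ∈? labels S
    ... | yes n∈S = subst (n ∈_) (sym subtree-W) n∈S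
    ... | no n∉S = ⊥-elim (changed (sym (localInfo-replace q t W S nothing n getW lbl
                                            (λ n∈W → n∉S (∈-resp-↭ (↭-sym S↭W) n∈W)) n∉S)))

  labelAtR-get : ∀ r {N} → get (reverse r) t ≡ just N → labelAtR r t ≡ just (label N)
  labelAtR-get r e rewrite e = refl

  rotateUp-candidate : ∀ rz sy su iz Z₁ Z₂ iy Y₁ Y₂ → get (reverse rz) t ≡ just (node iz Z₁ Z₂) →
    child sy Z₁ Z₂ ≡ node iy Y₁ Y₂ → allowed ex t (child (flipSide su) Y₁ Y₂) (child (flipSide sy) Z₁ Z₂) ≡ true →
    Σ TopTree λ S → IsCandidate iz iy (child su Y₁ Y₂) (child (flipSide su) Y₁ Y₂) (child (flipSide sy) Z₁ Z₂) S ×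
      rotL ex (just t) (just (label (child su Y₁ Y₂))) ≡ just (replace (reverse rz) S t)
  rotateUp-candidate rz sy su iz Z₁ Z₂ iy Y₁ Y₂ getZ y≡ ok
    with S , isC , rotated ← rotateUpAt-candidate ex t rz sy su iz Z₁ Z₂ iy Y₁ Y₂ getZ y≡ ok
    rewrite findPath-get (reverse (su ∷ sy ∷ rz)) t (child su Y₁ Y₂) uniq
              (get-grandchild su sy rz t iz Z₁ Z₂ iy Y₁ Y₂ getZ y≡)
          | reverse-involutive (su ∷ sy ∷ rz) = S , isC , rotated

  rotation-good : ∀ {d k} rz sy su iz Z₁ Z₂ iy Y₁ Y₂ → get (reverse rz) t ≡ just (node iz Z₁ Z₂) →
    child sy Z₁ Z₂ ≡ node iy Y₁ Y₂ → allowed ex t (child (flipSide su) Y₁ Y₂) (child (flipSide sy) Z₁ Z₂) ≡ true →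
    AtDepth x (child su Y₁ Y₂) k → ReturnDepths d (length rz) (suc k) →
    GoodResult d (finish (rotL ex (just t) (labelAtR (su ∷ sy ∷ rz) t)) (labelAtR rz t))
  rotation-good {d} {k} rz sy su iz Z₁ Z₂ iy Y₁ Y₂ getZ y≡ ok atU depths
    with S , isC , rotated ← rotateUp-candidate rz sy su iz Z₁ Z₂ iy Y₁ Y₂ getZ y≡ ok
    rewrite labelAtR-get (su ∷ sy ∷ rz) (get-grandchild su sy rz t iz Z₁ Z₂ iy Y₁ Y₂ getZ y≡)
          | rotated | labelAtR-get rz getZ =
    replacement-good {d} (reverse rz) (node iz Z₁ Z₂) S getZ (labels-candidate isC) (label-candidate isC)
      (at-candidate isC atU) (subst (λ e → ReturnDepths d e (suc k)) (sym (length-reverse rz)) depths)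
    where open RotationSite iz Z₁ Z₂ sy iy Y₁ Y₂ su y≡

-- The cases of semi_splay_step

pointAt-get : ∀ ex t r {N} → get (reverse r) t ≡ just N → pointAt ex t r ≡ isPoint ex t N
pointAt-get ex t r e rewrite e = refl

pathAt-get : ∀ ex t r {N} → get (reverse r) t ≡ just N → pathAt ex t r ≡ isPath ex t N
pathAt-get ex t r e rewrite e = refl

FallsThrough : Exposure → TopTree → Side → Side → Side → List Side → Set
FallsThrough ex t sx sp sg rgg =
  (pointAt ex t (sx ∷ sp ∷ sg ∷ rgg) ∧ pointAt ex t (sg ∷ rgg)) ≡ false ×
  (pathAt ex t (sp ∷ sg ∷ rgg) ∧ (pathAt ex t (sg ∷ rgg) ∨ pointAt ex t rgg)) ≡ false

module _ (ex : Exposure) (t : TopTree) (sx sp sg : Side) (rgg : List Side) where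

  private
    rx rp rg : List Side
    rx = sx ∷ sp ∷ sg ∷ rgg
    rp = sp ∷ sg ∷ rgg
    rg = sg ∷ rgg
    bothPoints pathParent : Bool
    bothPoints = pointAt ex t rx ∧ pointAt ex t rg
    pathParent = pathAt ex t rp ∧ (pathAt ex t rg ∨ pointAt ex t rgg)

  step-points : bothPoints ≡ true → step ex t rx ≡ finish (rotL ex (just t) (labelAtR rx t)) (labelAtR rg t)
  step-points c₁ rewrite c₁ = refl

  step-zigzig-x : bothPoints ≡ false → pathParent ≡ true → sameSide sx sp ≡ true →
    step ex t rx ≡ finish (rotL ex (just t) (labelAtR rx t)) (labelAtR rg t)
  step-zigzig-x c₁ c₂ s₁ rewrite c₁ | c₂ | s₁ = refl

  step-zigzig-p : bothPoints ≡ false → pathParent ≡ true → sameSide sx sp ≡ false → sameSide sp sg ≡ true →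
    step ex t rx ≡ finish (rotL ex (just t) (labelAtR rp t)) (labelAtR rgg t)
  step-zigzig-p c₁ c₂ s₁ s₂ rewrite c₁ | c₂ | s₁ | s₂ = refl

  step-zigzag : bothPoints ≡ false → pathParent ≡ true → sameSide sx sp ≡ false → sameSide sp sg ≡ false →
    step ex t rx ≡ finish (rotL ex (rotL ex (just t) (labelAtR (flipSide sx ∷ rp) t)) (labelAtR rp t)) (labelAtR rgg t)
  step-zigzag c₁ c₂ s₁ s₂ rewrite c₁ | c₂ | s₁ | s₂ = refl

  step-climb : FallsThrough ex t sx sp sg rgg → step ex t rx ≡ step ex t rp
  step-climb (c₁ , c₂) rewrite c₁ | c₂ = refl

-- pᵢ and qᵢ are pointAt and pathAt at the i-th proper ancestor of x; the hypotheses say that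
-- the step falls through at x, at its parent and at its grandparent.
three-fall-throughs-impossible : ∀ {p₁ p₂ p₃ p₄ p₅ q₁ q₂ q₃ q₄ : Bool} →
  q₁ ≡ not p₁ → q₂ ≡ not p₂ → q₃ ≡ not p₃ → q₄ ≡ not p₄ →
  (q₁ ∧ (q₂ ∨ p₃)) ≡ false → (p₁ ∧ p₃) ≡ false → (q₂ ∧ (q₃ ∨ p₄)) ≡ false → (p₂ ∧ p₄) ≡ false →
  (q₃ ∧ (q₄ ∨ p₅)) ≡ false → ⊥
three-fall-throughs-impossible {p₁} {p₂} {p₃} {p₄} {p₅} refl refl refl refl = cases p₁ p₂ p₃ p₄ p₅
  where
  cases : ∀ p₁ p₂ p₃ p₄ p₅ → (not p₁ ∧ (not p₂ ∨ p₃)) ≡ false → (p₁ ∧ p₃) ≡ false →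
    (not p₂ ∧ (not p₃ ∨ p₄)) ≡ false → (p₂ ∧ p₄) ≡ false → (not p₃ ∧ (not p₄ ∨ p₅)) ≡ false → ⊥
  cases true  _     true  _     _ _  () _  _  _
  cases false true  true  _     _ () _  _  _  _
  cases _     true  false true  _ _  _  _  () _
  cases _     true  false false _ _  _  _  _  ()
  cases _     false false _     _ _  _  () _  _
  cases _     false true  true  _ _  _  () _  _
  cases false false true  false _ () _  _  _  _

module SemiSplay (ex : Exposure) (t : TopTree) (ot : IsOrientedTopTree ex t) (x : Label) where
  open IsOrientedTopTree ot
  open Clusters ex (deg t)
  open Replacement ex t uniqueLabels x

  valid-at : ∀ q {s} → get q t ≡ just s → AtMost₂ (Boundary (deg s))
  valid-at q {s} e = valid⇒AtMost₂ ex t s (AllNodes-get q t s allValid e)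

  joint-at : ∀ q {i L R} → get q t ≡ just (node i L R) →
    Σ Vertex λ c → central (node i L R) ≡ just c × JoinedAt (deg L) (deg R) c
  joint-at q {i} {L} {R} e = shareOne⇒central i L R (AllNodes-get q t (node i L R) shareOne e)

  module Site (rz : List Side) (iz : Label) (Z₁ Z₂ : TopTree) (sy : Side) (iy : Label) (Y₁ Y₂ : TopTree) (su : Side)
              (getZ : get (reverse rz) t ≡ just (node iz Z₁ Z₂)) (y≡ : child sy Z₁ Z₂ ≡ node iy Y₁ Y₂) where

    open RotationSite iz Z₁ Z₂ sy iy Y₁ Y₂ su y≡ public

    getY : get (reverse (sy ∷ rz)) t ≡ just y
    getY = trans (get-reverse-∷ sy rz t iz Z₁ Z₂ getZ) (cong just y≡)

    jointY : Σ Vertex λ c → central y ≡ just c × JoinedAt (deg Y₁) (deg Y₂) c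
    jointY = joint-at (reverse (sy ∷ rz)) getY

    jointZ : Σ Vertex λ c → central z ≡ just c × JoinedAt (deg Z₁) (deg Z₂) c
    jointZ = joint-at (reverse rz) getZ

    cy cz : Vertex
    cy = proj₁ jointY
    cz = proj₁ jointZ

    joinY : JoinedAt (deg u) (deg a) cy
    joinY = JoinedAt-children su Y₁ Y₂ (proj₂ (proj₂ jointY))

    joinZ : JoinedAt (deg y) (deg b) cz
    joinZ = subst (λ c → JoinedAt (deg c) (deg b) cz) y≡ (JoinedAt-children sy Z₁ Z₂ (proj₂ (proj₂ jointZ)))

    outermost : Outermost ex (deg t) (deg y) (deg (child (flipSide sy) Y₁ Y₂)) cy cz
    outermost = child-outermost ex t iz Z₁ Z₂ cz sy iy Y₁ Y₂ cy (AllNodes-get (reverse rz) t z oriented getZ)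
                  (proj₁ (proj₂ jointZ)) y≡ (proj₁ (proj₂ jointY)) (proj₂ (proj₂ jointY))

    outermost-a : su ≡ sy → Outermost ex (deg t) (deg y) (deg a) cy cz
    outermost-a refl = outermost

    valid-a : AtMost₂ (Boundary (deg a))
    valid-a = valid-at (reverse (flipSide su ∷ sy ∷ rz)) (get-reverse-∷ (flipSide su) (sy ∷ rz) t iy Y₁ Y₂ getY)

    valid-b : AtMost₂ (Boundary (deg b))
    valid-b = valid-at (reverse (flipSide sy ∷ rz)) (get-reverse-∷ (flipSide sy) rz t iz Z₁ Z₂ getZ)

    open Rotation (deg u) (deg a) (deg b) (deg y) (deg z) deg-y deg-z (deg-get-≤ (reverse rz) t z getZ)

    allowed-points : T (isPoint ex t u) → T (isPoint ex t z) → allowed ex t a b ≡ true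
    allowed-points pointU pointZ =
      allowed-if-valid ex t a b (points-valid joinY joinZ (point⇒AtMost₁ ex t u pointU) (point⇒AtMost₁ ex t z pointZ))

    allowed-zigzig-path : su ≡ sy → T (isPath ex t y) → allowed ex t a b ≡ true
    allowed-zigzig-path su≡sy pathY = allowed-if-valid ex t a b
      (zigzig-path-valid joinY joinZ (outermost-a su≡sy) (path⇒TwoDistinct ex t y pathY) valid-a valid-b
        (valid-at (reverse rz) getZ))

    allowed-zigzig-point : su ≡ sy → T (isPoint ex t z) → allowed ex t a b ≡ true
    allowed-zigzig-point su≡sy pointZ = allowed-if-valid ex t a b
      (zigzig-point-valid joinY joinZ (proj₁ (proj₂ (outermost-a su≡sy))) (point⇒AtMost₁ ex t z pointZ))

  -- The step at X, k ≤ 2 levels above x, below its parent P, grandparent G and great-grandparent GG.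
  module Level (rgg : List Side) (sg sp sx : Side) (igg : Label) (GG₁ GG₂ : TopTree) (ig : Label) (G₁ G₂ : TopTree)
               (ip : Label) (P₁ P₂ : TopTree) (getGG : get (reverse rgg) t ≡ just (node igg GG₁ GG₂))
               (G≡ : child sg GG₁ GG₂ ≡ node ig G₁ G₂) (P≡ : child sp G₁ G₂ ≡ node ip P₁ P₂)
               {k : ℕ} (atX : AtDepth x (child sx P₁ P₂) k) (k≤2 : k ≤ 2) where

    d : ℕ
    d = 3 + k + length rgg

    GG G P X : TopTree
    GG = node igg GG₁ GG₂
    G  = node ig G₁ G₂
    P  = node ip P₁ P₂
    X  = child sx P₁ P₂

    module RotP = Site rgg igg GG₁ GG₂ sg ig G₁ G₂ sp getGG G≡
    module RotX = Site (sg ∷ rgg) ig G₁ G₂ sp ip P₁ P₂ sx RotP.getY P≡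
    module RotS = Site (sg ∷ rgg) ig G₁ G₂ sp ip P₁ P₂ (flipSide sx) RotP.getY P≡

    getX : get (reverse (sx ∷ sp ∷ sg ∷ rgg)) t ≡ just X
    getX = get-reverse-∷ sx (sp ∷ sg ∷ rgg) t ip P₁ P₂ RotX.getY

    rotate-x : allowed ex t RotX.a RotX.b ≡ true →
      GoodResult d (finish (rotL ex (just t) (labelAtR (sx ∷ sp ∷ sg ∷ rgg) t)) (labelAtR (sg ∷ rgg) t))
    rotate-x ok = rotation-good {d} (sg ∷ rgg) sp sx ig G₁ G₂ ip P₁ P₂ RotP.getY P≡ ok atX
      (return-grandparent (length rgg) k k≤2)

    rotate-p : allowed ex t RotP.a RotP.b ≡ true →
      GoodResult d (finish (rotL ex (just t) (labelAtR (sp ∷ sg ∷ rgg) t)) (labelAtR rgg t))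
    rotate-p ok = rotation-good {d} rgg sg sp igg GG₁ GG₂ ig G₁ G₂ getGG G≡ ok
      (subst (λ c → AtDepth x c (suc k)) (sym P≡) (at-child sx ip P₁ P₂ atX))
      (return-great-grandparent (length rgg) k k≤2)

    zigzag-valid : sp ≡ flipSide sg → sx ≡ flipSide sp → T (isPath ex t P) → T (isPath ex t G) ⊎ T (isPoint ex t GG) →
      ValidUnion (deg RotS.u) (deg RotP.b)
    zigzag-valid refl refl pathP pathG⊎pointGG =
      DoubleRotation.zigzag-valid (deg X) (deg RotX.a) (deg RotX.b) (deg RotP.b) (deg P) (deg G) (deg GG)
        RotX.deg-y (λ w → trans (RotX.deg-z w) (+-comm (deg P w) (deg RotX.b w))) RotP.deg-z
        (deg-get-≤ (reverse rgg) t GG getGG) RotX.joinY (JoinedAt-sym RotX.joinZ) RotP.joinZ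
        (subst (λ c → Outermost ex (deg t) (deg G) (deg c) RotP.cy RotP.cz) P≡ RotP.outermost) RotX.outermost
        (path⇒TwoDistinct ex t P pathP) (valid-at (reverse (sx ∷ sp ∷ sg ∷ rgg)) getX)
        (valid-at (reverse (sp ∷ sg ∷ rgg)) RotX.getY)
        (Sum.map (path⇒TwoDistinct ex t G) (point⇒AtMost₁ ex t GG) pathG⊎pointGG)
        RotP.valid-b (valid-at (reverse (sg ∷ rgg)) RotP.getY) (valid-at (reverse rgg) getGG)

    module AfterFirst {S₁} (isC₁ : IsCandidate ig ip RotS.u RotS.a RotS.b S₁) where

      t₁ : TopTree
      t₁ = replace (reverse (sg ∷ rgg)) S₁ t

      unique₁ : Unique (labels t₁)
      unique₁ = Unique-resp-↭
        (↭-sym (labels-replace (reverse (sg ∷ rgg)) t G S₁ RotP.getY (RotS.labels-candidate isC₁))) uniqueLabels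

      deg-t₁ : ∀ w → deg t₁ w ≡ deg t w
      deg-t₁ = deg-replace (reverse (sg ∷ rgg)) t G S₁ RotP.getY (RotS.deg-candidate isC₁)

      open Replacement ex t₁ unique₁ x public using (rotateUp-candidate)

    zigzag-second : ∀ {S₁} → IsCandidate ig ip RotS.u RotS.a RotS.b S₁ → ValidUnion (deg RotS.u) (deg RotP.b) →
      GoodResult d (finish (rotL ex (just (replace (reverse (sg ∷ rgg)) S₁ t)) (just ip)) (just igg))
    zigzag-second isC₁ valid
      with Y₁ , Y₂ , sP , refl , P′-label , at-P′ , deg-u′ ← candidate-view isC₁
      with GG₁′ , GG₂′ , getGG′ , S₁-side , b₂-side ← get-replace-parent sg rgg t (node ig Y₁ Y₂) igg GG₁ GG₂ getGG
      with S₂ , isC₂ , rotated₂ ← AfterFirst.rotateUp-candidate isC₁ rgg sg sP igg GG₁′ GG₂′ ig Y₁ Y₂ getGG′ S₁-side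
             (allowed-if-valid ex (AfterFirst.t₁ isC₁) (child (flipSide sP) Y₁ Y₂) (child (flipSide sg) GG₁′ GG₂′)
               (ValidUnion-resp ex (AfterFirst.deg-t₁ isC₁) deg-u′ (λ w → cong (λ c → deg c w) b₂-side) valid))
      = subst (λ m → GoodResult d (finish m (just igg))) (sym rotated)
          (subst (λ T → GoodResult d (ret T igg)) (sym replaced)
            (replacement-good {d} (reverse rgg) GG S₂ getGG labels-S₂ (Site₂.label-candidate isC₂)
              (Site₂.at-candidate isC₂
                (at-P′ (subst (λ s → AtDepth x (child s P₁ P₂) k) (sym (flipSide-involutive sx)) atX)))
              (subst (λ e → ReturnDepths d e (suc (suc k))) (sym (length-reverse rgg))
                (return-great-grandparent (length rgg) k k≤2))))
      where
      module Site₂ = RotationSite igg GG₁′ GG₂′ sg ig Y₁ Y₂ sP S₁-side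
      t₁ : TopTree
      t₁ = AfterFirst.t₁ isC₁
      rotated : rotL ex (just t₁) (just ip) ≡ just (replace (reverse rgg) S₂ t₁)
      rotated = trans (cong (λ l → rotL ex (just t₁) (just l)) (sym P′-label)) rotated₂
      replaced : replace (reverse rgg) S₂ t₁ ≡ replace (reverse rgg) S₂ t
      replaced = trans (cong (λ q → replace (reverse rgg) S₂ (replace q (node ig Y₁ Y₂) t)) (unfold-reverse sg rgg))
                       (replace-replace (reverse rgg) (sg ∷ []) S₂ (node ig Y₁ Y₂) t)
      labels-S₂ : labels S₂ ↭ labels GG
      labels-S₂ = ↭-trans (Site₂.labels-candidate isC₂) (labels-child-replaced sg igg S₁-side b₂-side
                    (subst (λ c → labels (node ig Y₁ Y₂) ↭ labels c) (sym G≡) (RotS.labels-candidate isC₁)))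

    zigzag : sp ≡ flipSide sg → sx ≡ flipSide sp → T (isPath ex t P) → T (isPath ex t G) ⊎ T (isPoint ex t GG) →
      GoodResult d (finish (rotL ex (rotL ex (just t) (labelAtR (flipSide sx ∷ sp ∷ sg ∷ rgg) t))
                                    (labelAtR (sp ∷ sg ∷ rgg) t))
                           (labelAtR rgg t))
    zigzag sp≡ sx≡ pathP pathG⊎pointGG
      with S₁ , isC₁ , rotated₁ ← rotateUp-candidate (sg ∷ rgg) sp (flipSide sx) ig G₁ G₂ ip P₁ P₂ RotP.getY P≡
             (RotS.allowed-zigzig-path (trans (cong flipSide sx≡) (flipSide-involutive sp)) pathP)
      rewrite labelAtR-get (flipSide sx ∷ sp ∷ sg ∷ rgg)
                (get-reverse-∷ (flipSide sx) (sp ∷ sg ∷ rgg) t ip P₁ P₂ RotX.getY)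
            | rotated₁ | labelAtR-get (sp ∷ sg ∷ rgg) RotX.getY | labelAtR-get rgg getGG =
      zigzag-second isC₁ (zigzag-valid sp≡ sx≡ pathP pathG⊎pointGG)

    bothPoints pathParent : Bool
    bothPoints = isPoint ex t X ∧ isPoint ex t G
    pathParent = isPath ex t P ∧ (isPath ex t G ∨ isPoint ex t GG)

    bothPoints≡ : (pointAt ex t (sx ∷ sp ∷ sg ∷ rgg) ∧ pointAt ex t (sg ∷ rgg)) ≡ bothPoints
    bothPoints≡ = cong₂ _∧_ (pointAt-get ex t (sx ∷ sp ∷ sg ∷ rgg) getX) (pointAt-get ex t (sg ∷ rgg) RotP.getY)

    pathParent≡ : (pathAt ex t (sp ∷ sg ∷ rgg) ∧ (pathAt ex t (sg ∷ rgg) ∨ pointAt ex t rgg)) ≡ pathParent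
    pathParent≡ = cong₂ _∧_ (pathAt-get ex t (sp ∷ sg ∷ rgg) RotX.getY)
                            (cong₂ _∨_ (pathAt-get ex t (sg ∷ rgg) RotP.getY) (pointAt-get ex t rgg getGG))

    path-parent-case : bothPoints ≡ false → pathParent ≡ true → ∀ b₁ b₂ → sameSide sx sp ≡ b₁ → sameSide sp sg ≡ b₂ →
      GoodResult d (step ex t (sx ∷ sp ∷ sg ∷ rgg))
    path-parent-case c₁ c₂ true _ s₁ _ =
      subst (GoodResult d) (sym (step-zigzig-x ex t sx sp sg rgg (trans bothPoints≡ c₁) (trans pathParent≡ c₂) s₁))
        (rotate-x (RotX.allowed-zigzig-path (sameSide-true s₁) pathP))
      where pathP = proj₁ (∧-true {isPath ex t P} c₂)
    path-parent-case c₁ c₂ false true s₁ s₂ =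
      subst (GoodResult d) (sym (step-zigzig-p ex t sx sp sg rgg (trans bothPoints≡ c₁) (trans pathParent≡ c₂) s₁ s₂))
        (rotate-p (Sum.[ RotP.allowed-zigzig-path (sameSide-true s₂) , RotP.allowed-zigzig-point (sameSide-true s₂) ]′
                     (∨-true {isPath ex t G} (Equivalence.to T-≡ (proj₂ (∧-true {isPath ex t P} c₂))))))
    path-parent-case c₁ c₂ false false s₁ s₂ =
      subst (GoodResult d) (sym (step-zigzag ex t sx sp sg rgg (trans bothPoints≡ c₁) (trans pathParent≡ c₂) s₁ s₂))
        (zigzag (sameSide-false s₂) (sameSide-false s₁) (proj₁ (∧-true {isPath ex t P} c₂))
           (∨-true {isPath ex t G} (Equivalence.to T-≡ (proj₂ (∧-true {isPath ex t P} c₂)))))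

    level : GoodResult d (step ex t (sx ∷ sp ∷ sg ∷ rgg)) ⊎ FallsThrough ex t sx sp sg rgg
    level with bothPoints in c₁
    ... | true with pointX , pointG ← ∧-true {isPoint ex t X} c₁ =
      inj₁ (subst (GoodResult d) (sym (step-points ex t sx sp sg rgg (trans bothPoints≡ c₁)))
             (rotate-x (RotX.allowed-points pointX pointG)))
    ... | false with pathParent in c₂
    ...   | false = inj₂ (trans bothPoints≡ c₁ , trans pathParent≡ c₂)
    ...   | true  = inj₁ (path-parent-case c₁ c₂ (sameSide sx sp) (sameSide sp sg) refl refl)

  pathAt≡not-pointAt : ∀ r {N} → get (reverse r) t ≡ just N → pathAt ex t r ≡ not (pointAt ex t r)
  pathAt≡not-pointAt r {N} e rewrite e = isPath≡not-isPoint ex t N (AllNodes-get (reverse r) t N allValid e)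

  good-at : ∀ r {X₀} → get (reverse r) t ≡ just X₀ → label X₀ ≡ x → 5 ≤ length r → GoodResult (length r) (step ex t r)
  good-at []                      _ _ ()
  good-at (_ ∷ [])                _ _ (s≤s ())
  good-at (_ ∷ _ ∷ [])            _ _ (s≤s (s≤s ()))
  good-at (_ ∷ _ ∷ _ ∷ [])        _ _ (s≤s (s≤s (s≤s ())))
  good-at (_ ∷ _ ∷ _ ∷ _ ∷ [])    _ _ (s≤s (s≤s (s≤s (s≤s ()))))
  good-at (s₀ ∷ s₁ ∷ s₂ ∷ s₃ ∷ s₄ ∷ rest) {X₀} get₀ refl _
    with i₁ , L₁ , R₁ , get₁ , X₀≡ ← get-reverse-∷⁻ s₀ (s₁ ∷ s₂ ∷ s₃ ∷ s₄ ∷ rest) t X₀ get₀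
    with i₂ , L₂ , R₂ , get₂ , N₁≡ ← get-reverse-∷⁻ s₁ (s₂ ∷ s₃ ∷ s₄ ∷ rest) t _ get₁
    with i₃ , L₃ , R₃ , get₃ , N₂≡ ← get-reverse-∷⁻ s₂ (s₃ ∷ s₄ ∷ rest) t _ get₂
    with i₄ , L₄ , R₄ , get₄ , N₃≡ ← get-reverse-∷⁻ s₃ (s₄ ∷ rest) t _ get₃
    with i₅ , L₅ , R₅ , get₅ , N₄≡ ← get-reverse-∷⁻ s₄ rest t _ get₄
    with Level.level (s₃ ∷ s₄ ∷ rest) s₂ s₁ s₀ i₃ L₃ R₃ i₂ L₂ R₂ i₁ L₁ R₁ get₃ N₂≡ N₁≡ at₀ z≤n
       | Level.level (s₄ ∷ rest) s₃ s₂ s₁ i₄ L₄ R₄ i₃ L₃ R₃ i₂ L₂ R₂ get₄ N₃≡ N₂≡ at₁ (s≤s z≤n)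
       | Level.level rest s₄ s₃ s₂ i₅ L₅ R₅ i₄ L₄ R₄ i₃ L₃ R₃ get₅ N₄≡ N₃≡ at₂ (s≤s (s≤s z≤n))
    where
    at₀ : AtDepth (label X₀) (child s₀ L₁ R₁) 0
    at₀ = subst (λ c → AtDepth (label X₀) c 0) (sym X₀≡) (at-root X₀)
    at₁ : AtDepth (label X₀) (child s₁ L₂ R₂) 1
    at₁ = subst (λ c → AtDepth (label X₀) c 1) (sym N₁≡) (at-child s₀ i₁ L₁ R₁ at₀)
    at₂ : AtDepth (label X₀) (child s₂ L₃ R₃) 2
    at₂ = subst (λ c → AtDepth (label X₀) c 2) (sym N₂≡) (at-child s₁ i₂ L₂ R₂ at₁)
  ... | inj₁ good | _ | _ = good
  ... | inj₂ fall₀ | inj₁ good | _ =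
    subst (GoodResult (5 + length rest)) (sym (step-climb ex t s₀ s₁ s₂ (s₃ ∷ s₄ ∷ rest) fall₀)) good
  ... | inj₂ fall₀ | inj₂ fall₁ | inj₁ good =
    subst (GoodResult (5 + length rest))
      (sym (trans (step-climb ex t s₀ s₁ s₂ (s₃ ∷ s₄ ∷ rest) fall₀) (step-climb ex t s₁ s₂ s₃ (s₄ ∷ rest) fall₁))) good
  ... | inj₂ fall₀ | inj₂ fall₁ | inj₂ fall₂ = ⊥-elim (three-fall-throughs-impossible
    (pathAt≡not-pointAt (s₁ ∷ s₂ ∷ s₃ ∷ s₄ ∷ rest) get₁) (pathAt≡not-pointAt (s₂ ∷ s₃ ∷ s₄ ∷ rest) get₂)
    (pathAt≡not-pointAt (s₃ ∷ s₄ ∷ rest) get₃) (pathAt≡not-pointAt (s₄ ∷ rest) get₄)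
    (proj₂ fall₀) (proj₁ fall₁) (proj₂ fall₁) (proj₁ fall₂) (proj₂ fall₂))

  semiSplayStep-good : ∀ d → depth x t ≡ just d → 5 ≤ d → GoodResult d (semiSplayStep ex t x)
  semiSplayStep-good d depth≡ 5≤d with findPath x t in found
  semiSplayStep-good d () 5≤d | nothing
  ... | just p with refl ← depth≡ with X₀ , getX₀ , refl ← findPath⇒get x t p found =
    subst (λ e → GoodResult e (step ex t (reverse p))) (length-reverse p)
      (good-at (reverse p) (subst (λ q → get q t ≡ just X₀) (sym (reverse-involutive p)) getX₀) refl
        (subst (5 ≤_) (sym (length-reverse p)) 5≤d))

lemma5p2 : (ex : Exposure) (t : TopTree) → IsOrientedTopTree ex t →
    (x : Label) (d : ℕ) → depth x t ≡ just d → 5 ≤ d →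
    Σ TopTree λ t′ → Σ Label λ x′ →
      semiSplayStep ex t x ≡ ret t′ x′
      × depth x t′ ≡ just (d ∸ 1)
      × (Σ ℕ λ e → depth x′ t′ ≡ just e × d ∸ 5 ≤ e × e ≤ d ∸ 2)
      × (∀ n → Modified t t′ n → n ∈ subtreeLabels x′ t′)
lemma5p2 ex t ot x = SemiSplay.semiSplayStep-good ex t ot x
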